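{- Let $n,k$ be integers with $k+2\le n$. For a uniformly random labelled tree on $[n]=\{1,\ldots,n\}$ and an independent set $I$, let $e(I)$ denote the number of vertices $v\notin I$ such that $I\cup\{v\}$ is independent. Let $g_1(n,k)$ be the expected number of independent sets $I$ of size $k$ with $e(I)\le k+1$, and let $g_2(n,k)$ be the expected number of independent sets $I$ of size $k$ with $e(I)\ge k+1$. For a tree $T$ let $i_j=i_j(T)$ be the number of independent sets of size $j$ in $T$. (1) If $g_1(n,k)\le \binom{n-k+1}{k}\big/(n^2\log n)$, then all but a proportion at most $1/(n\log n)$ of the labelled trees on $[n]$ satisfy $i_k\le i_{k+1}$. (2) If $g_2(n,k)\le \binom{n-k}{k+1}\big/(n^2\log n)$, then all but a proportion at most $1/(n\log n)$ of the labelled trees on $[n]$ satisfy $i_{k+1}\le i_k$.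
   Context: An independent set is a set of mutually non-adjacent vertices. The uniformly random labelled tree on $[n]$ is chosen uniformly among the $n^{n-2}$ trees on vertex set $[n]$. -}

module Defs where

open import Data.Nat using (ℕ; zero; suc; _+_; _*_; _∸_; _^_; _≡ᵇ_; _<ᵇ_; _≤ᵇ_)
open import Data.Nat.Properties using (_!≢0)
open import Data.Nat.Combinatorics using (_C_)
open import Data.Nat.Base using (_!)
open import Data.Bool using (Bool; true; false; _∧_; _∨_; not; if_then_else_)
open import Data.Fin using (Fin; zero; suc; toℕ)
open import Data.List using (List; []; _∷_; [_]; map; concatMap; allFin; length; filter)
open import Data.Nat.ListAction using (sum)
open import Data.Product using (∃)
open import Data.Integer using (+_)
import Data.Rational as ℚ
open import Data.Rational using (ℚ)
open import Relation.Binary.PropositionalEquality using (_≡_)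

allFuns : {A : Set} (n : ℕ) → List A → List (Fin n → A)
allFuns zero    xs = [ (λ ()) ]
allFuns (suc n) xs =
  concatMap (λ a → map (λ f → λ { zero → a ; (suc i) → f i }) (allFuns n xs)) xs

countB : {A : Set} → (A → Bool) → List A → ℕ
countB p []       = 0
countB p (x ∷ xs) = if p x then suc (countB p xs) else countB p xs

allB : {A : Set} → (A → Bool) → List A → Bool
allB p []       = true
allB p (x ∷ xs) = p x ∧ allB p xs

anyB : {A : Set} → (A → Bool) → List A → Bool
anyB p []       = false
anyB p (x ∷ xs) = p x ∨ anyB p xs

Graph : ℕ → Set
Graph n = Fin n → Fin n → Bool

allGraphs : (n : ℕ) → List (Graph n)
allGraphs n = allFuns n (allFuns n (true ∷ false ∷ []))

_==_ : {n : ℕ} → Fin n → Fin n → Bool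
i == j = toℕ i ≡ᵇ toℕ j

symmetricB : {n : ℕ} → Graph n → Bool
symmetricB {n} G = allB (λ i → allB (λ j → not (G i j ∧ not (G j i))) (allFin n)) (allFin n)

irreflexiveB : {n : ℕ} → Graph n → Bool
irreflexiveB {n} G = allB (λ i → not (G i i)) (allFin n)

numEdges : {n : ℕ} → Graph n → ℕ
numEdges {n} G =
  sum (map (λ i → countB (λ j → (toℕ i <ᵇ toℕ j) ∧ G i j) (allFin n)) (allFin n))

reachStep : {n : ℕ} → Graph n → (Fin n → Bool) → (Fin n → Bool)
reachStep {n} G R v = R v ∨ anyB (λ u → R u ∧ G u v) (allFin n)

iter : {A : Set} → ℕ → (A → A) → A → A
iter zero    f x = x
iter (suc m) f x = f (iter m f x)

-- every vertex is reachable from vertex 0 (vacuous for n = 0)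
connectedB : {n : ℕ} → Graph n → Bool
connectedB {n} G =
  allB (iter n (reachStep G) (λ v → toℕ v ≡ᵇ 0)) (allFin n)

isTreeB : {n : ℕ} → Graph n → Bool
isTreeB {n} G = symmetricB G ∧ irreflexiveB G ∧ connectedB G ∧ (numEdges G ≡ᵇ n ∸ 1)

labelledTrees : (n : ℕ) → List (Graph n)
labelledTrees n = filter (λ G → Data.Bool.T? (isTreeB G)) (allGraphs n)
  where import Data.Bool

numTrees : ℕ → ℕ
numTrees n = length (labelledTrees n)

VSet : ℕ → Set
VSet n = Fin n → Bool

allVSets : (n : ℕ) → List (VSet n)
allVSets n = allFuns n (true ∷ false ∷ [])

size : {n : ℕ} → VSet n → ℕ
size {n} I = countB I (allFin n)

independentB : {n : ℕ} → Graph n → VSet n → Bool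
independentB {n} G I =
  allB (λ i → allB (λ j → not (I i ∧ I j ∧ G i j)) (allFin n)) (allFin n)

insert : {n : ℕ} → Fin n → VSet n → VSet n
insert v I u = I u ∨ (u == v)

ext : {n : ℕ} → Graph n → VSet n → ℕ
ext {n} G I = countB (λ v → not (I v) ∧ independentB G (insert v I)) (allFin n)

indepCount : {n : ℕ} → Graph n → ℕ → ℕ
indepCount {n} G j = countB (λ I → independentB G I ∧ (size I ≡ᵇ j)) (allVSets n)

-- sums over all labelled trees (expectations are these divided by numTrees n)
-- S₁(n,k) = Σ_T #{ independent I, |I| = k, e(I) ≤ k+1 }
S₁ : ℕ → ℕ → ℕ
S₁ n k = sum (map (λ T → countB (λ I → independentB T I ∧ (size I ≡ᵇ k)
                                     ∧ (ext T I ≤ᵇ suc k)) (allVSets n))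
                  (labelledTrees n))

S₂ : ℕ → ℕ → ℕ
S₂ n k = sum (map (λ T → countB (λ I → independentB T I ∧ (size I ≡ᵇ k)
                                     ∧ (suc k ≤ᵇ ext T I)) (allVSets n))
                  (labelledTrees n))

bad₁ : ℕ → ℕ → ℕ
bad₁ n k = countB (λ T → not (indepCount T k ≤ᵇ indepCount T (suc k))) (labelledTrees n)

bad₂ : ℕ → ℕ → ℕ
bad₂ n k = countB (λ T → not (indepCount T (suc k) ≤ᵇ indepCount T k)) (labelledTrees n)

-- Real inequality  a · ln n ≤ b  (a, b, n natural) without real numbers.
-- a·ln n ≤ b  ⇔  n^a ≤ e^b  ⇔  ∃ m. n^a ≤ Σ_{j ≤ m} b^j / j!
-- (the partial sums increase to e^b; equality n^a = e^b forces b = 0,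
--  where the partial sums are all 1.)

expPartial : ℕ → ℕ → ℚ
expPartial b zero    = ℚ.1ℚ
expPartial b (suc m) =
  expPartial b m ℚ.+ ((+ (b ^ suc m)) ℚ./ (suc m !)) {{suc m !≢0}}

MulLogLe : (a n b : ℕ) → Set
MulLogLe a n b = ∃ λ m → (+ (n ^ a)) ℚ./ 1 ℚ.≤ expPartial b m

module Submission where

-- Both sides of  Σ_{I independent, |I| = k} e(I) = (k + 1) · i_{k+1}  count the pairs (I, v)
-- with I ∪ {v} independent of size k + 1.  Hence if i_k > i_{k+1}, at least i_k / (k + 2)
-- independent k-sets have e(I) ≤ k + 1, and if i_{k+1} > i_k, at least i_{k+1} / (n − k) of
-- them have e(I) ≥ k + 1, since e(I) ≤ n − k.  A tree has i_j ≥ C(n + 1 − j, j): in every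
-- vertex set S, a vertex of maximal BFS depth has at most one neighbour in S, and removing it
-- gives Pascal's recurrence.  So every bad tree contributes at least C/n to the sum whose
-- average is g, and Markov's inequality bounds the number of bad trees.  The logarithms are
-- expressed through the partial sums e_m of the exponential series, which satisfy
-- e_m(x + y) ≤ e_m(x) · e_m(y) by the binomial theorem.

open import Defs
open import Data.Bool using (Bool; true; false; _∧_; _∨_; not; if_then_else_; T; T?)
open import Data.Bool.Properties
  using (∧-assoc; ∧-comm; ∧-zeroʳ; ∧-identityʳ; ∨-identityʳ; T-∧; T-∨; T-≡)
open import Data.Empty using (⊥-elim)
open import Data.Fin using (Fin; zero; suc; toℕ; inject₁; fromℕ)
open import Data.Fin.Properties using (toℕ-injective; toℕ<n; toℕ-inject₁; toℕ-fromℕ)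
  renaming (suc-injective to Fin-suc-injective)
open import Data.List using (List; []; _∷_; _++_; map; length; allFin; tabulate; filter)
open import Data.List.Extrema.Nat using (argmax; argmax-all; f[xs]≤f[argmax])
open import Data.List.Membership.Propositional using (_∈_)
open import Data.List.Membership.Propositional.Properties using (∈-allFin; ∈-filter⁺)
open import Data.List.Properties using (map-tabulate; length-tabulate)
open import Data.List.Relation.Unary.All as All using (All; []; _∷_)
open import Data.List.Relation.Unary.All.Properties using (all-filter)
open import Data.List.Relation.Unary.Any using (here; there)
open import Data.Nat using (ℕ; zero; suc; pred; _!; NonZero; >-nonZero; _+_; _*_; _∸_; _^_; _≤_; _<_;
                            z≤n; s≤s; s≤s⁻¹; _≡ᵇ_; _≤ᵇ_; _<ᵇ_; +-0-rawMonoid)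
open import Data.Nat.Combinatorics using (_C_; nCk+nC[k+1]≡[n+1]C[k+1]; nCk≡n!/k![n-k]!; k![n∸k]!∣n!)
open import Data.Nat.DivMod using (m/n*n≡m)
open import Data.Nat.Induction using (<-rec)
open import Data.Nat.ListAction using (sum)
open import Data.Nat.Properties
open import Data.Nat.Solver using (module +-*-Solver)
open import Data.Product using (_×_; _,_; proj₁; proj₂; ∃-syntax)
open import Data.Sum using (_⊎_; inj₁; inj₂)
open import Data.Vec.Functional using () renaming (_∷_ to _∷ᵛ_)
open import Function using (_∘_; _⇔_; mk⇔; Equivalence)
open import Relation.Binary.Definitions using (Symmetric; Irreflexive)
open import Relation.Binary.PropositionalEquality
open import Relation.Nullary using (¬_; yes; no)
import Data.Integer as ℤ
import Data.Integer.Properties as ℤP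
import Data.Rational as ℚ
import Data.Rational.Properties as ℚP
import Data.Rational.Unnormalised as ℚᵘ
import Data.Rational.Unnormalised.Properties as ℚᵘP

open import Algebra.Properties.CommutativeSemigroup +-commutativeSemigroup
  using () renaming (interchange to +-interchange)
open import Algebra.Properties.CommutativeSemigroup *-commutativeSemigroup
  using () renaming (x∙yz≈y∙xz to x*[y*z]≡y*[x*z]; xy∙z≈y∙xz to [x*y]*z≡y*[x*z])
open import Algebra.Properties.Semiring.Sum +-*-semiring
  using ( sum-syntax; sum-cong-≗; sum-init-last; sum-replicate-zero
        ; ∑-distrib-+; *-distribˡ-sum; *-distribʳ-sum)
import Algebra.Properties.CommutativeSemiring.Binomial +-*-commutativeSemiring as Binomial
import Algebra.Properties.Semiring.Exp +-*-semiring as Exp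
import Algebra.Definitions.RawMonoid +-0-rawMonoid as RawMonoid
open +-*-Solver using (solve; _:+_; _:*_; _:=_; con)

-- Counting over lists

𝟙 : Bool → ℕ
𝟙 true  = 1
𝟙 false = 0

𝟙≤1 : ∀ b → 𝟙 b ≤ 1
𝟙≤1 true  = ≤-refl
𝟙≤1 false = z≤n

𝟙-T : ∀ {b} → T b → 𝟙 b ≡ 1
𝟙-T {true} _ = refl

𝟙-¬T : ∀ {b} → ¬ T b → 𝟙 b ≡ 0
𝟙-¬T {true}  ¬b = ⊥-elim (¬b _)
𝟙-¬T {false} _  = refl

T-∧-intro : ∀ {a b} → T a → T b → T (a ∧ b)
T-∧-intro ta tb = Equivalence.from T-∧ (ta , tb)

T-∧-elim : ∀ {a b} → T (a ∧ b) → T a × T b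
T-∧-elim = Equivalence.to T-∧

T-∨-elim : ∀ {a b} → T (a ∨ b) → T a ⊎ T b
T-∨-elim = Equivalence.to T-∨

T-∨-introˡ : ∀ {a} b → T a → T (a ∨ b)
T-∨-introˡ b ta = Equivalence.from T-∨ (inj₁ ta)

T-∨-introʳ : ∀ a {b} → T b → T (a ∨ b)
T-∨-introʳ a tb = Equivalence.from T-∨ (inj₂ tb)

T-not⇒¬T : ∀ {b} → T (not b) → ¬ T b
T-not⇒¬T {false} _ ()

¬T⇒T-not : ∀ {b} → ¬ T b → T (not b)
¬T⇒T-not {true}  ¬b = ¬b _
¬T⇒T-not {false} _  = _

¬T-≤ᵇ⇒> : ∀ {m n} → ¬ T (m ≤ᵇ n) → n < m
¬T-≤ᵇ⇒> ¬m≤ᵇn = ≰⇒> (¬m≤ᵇn ∘ ≤⇒≤ᵇ)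

𝟙-trichotomy : ∀ b x y → 𝟙 b ≡ 𝟙 (b ∧ (x <ᵇ y)) + 𝟙 (b ∧ (y <ᵇ x)) + 𝟙 (b ∧ (x ≡ᵇ y))
𝟙-trichotomy false x y = refl
𝟙-trichotomy true  x y = sym (exactly-one x y)
  where
    exactly-one : ∀ x y → 𝟙 (x <ᵇ y) + 𝟙 (y <ᵇ x) + 𝟙 (x ≡ᵇ y) ≡ 1
    exactly-one zero    zero    = refl
    exactly-one zero    (suc y) = refl
    exactly-one (suc x) zero    = refl
    exactly-one (suc x) (suc y) = exactly-one x y

==⇒≡ : ∀ {n} {u v : Fin n} → T (u == v) → u ≡ v
==⇒≡ {u = u} {v} h = toℕ-injective (≡ᵇ⇒≡ (toℕ u) (toℕ v) h)

==-refl : ∀ {n} (u : Fin n) → T (u == u)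
==-refl u = ≡⇒≡ᵇ (toℕ u) (toℕ u) refl

module _ {A : Set} where

  ∑ˡ-syntax : List A → (A → ℕ) → ℕ
  ∑ˡ-syntax xs f = sum (map f xs)

  syntax ∑ˡ-syntax xs (λ x → e) = ∑[ x ∈ xs ] e

  ∑ˡ-cong : ∀ {f g : A → ℕ} → (∀ x → f x ≡ g x) → ∀ xs →
            ∑[ x ∈ xs ] f x ≡ ∑[ x ∈ xs ] g x
  ∑ˡ-cong f≗g []       = refl
  ∑ˡ-cong f≗g (x ∷ xs) = cong₂ _+_ (f≗g x) (∑ˡ-cong f≗g xs)

  ∑ˡ-mono-≤ : ∀ {f g : A → ℕ} → (∀ x → f x ≤ g x) → ∀ xs →
              ∑[ x ∈ xs ] f x ≤ ∑[ x ∈ xs ] g x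
  ∑ˡ-mono-≤ f≤g []       = z≤n
  ∑ˡ-mono-≤ f≤g (x ∷ xs) = +-mono-≤ (f≤g x) (∑ˡ-mono-≤ f≤g xs)

  ∑ˡ-zero : ∀ xs → ∑[ x ∈ xs ] 0 ≡ 0
  ∑ˡ-zero []       = refl
  ∑ˡ-zero (x ∷ xs) = ∑ˡ-zero xs

  ∑ˡ-distrib-+ : ∀ (f g : A → ℕ) xs →
                 ∑[ x ∈ xs ] (f x + g x) ≡ ∑[ x ∈ xs ] f x + ∑[ x ∈ xs ] g x
  ∑ˡ-distrib-+ f g []       = refl
  ∑ˡ-distrib-+ f g (x ∷ xs) = begin
    f x + g x + ∑[ y ∈ xs ] (f y + g y)              ≡⟨ cong (f x + g x +_) (∑ˡ-distrib-+ f g xs) ⟩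
    f x + g x + (∑[ y ∈ xs ] f y + ∑[ y ∈ xs ] g y)  ≡⟨ +-interchange (f x) (g x) _ _ ⟩
    f x + ∑[ y ∈ xs ] f y + (g x + ∑[ y ∈ xs ] g y)  ∎
    where open ≡-Reasoning

  ∑ˡ-*ʳ : ∀ (f : A → ℕ) c xs → ∑[ x ∈ xs ] (f x * c) ≡ ∑[ x ∈ xs ] f x * c
  ∑ˡ-*ʳ f c []       = refl
  ∑ˡ-*ʳ f c (x ∷ xs) = trans (cong (f x * c +_) (∑ˡ-*ʳ f c xs)) (sym (*-distribʳ-+ c (f x) _))

  ∈⇒≤∑ˡ : ∀ (f : A → ℕ) {x xs} → x ∈ xs → f x ≤ ∑[ y ∈ xs ] f y
  ∈⇒≤∑ˡ f (here refl)  = m≤m+n _ _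
  ∈⇒≤∑ˡ f (there x∈xs) = ≤-trans (∈⇒≤∑ˡ f x∈xs) (m≤n+m _ _)

  ∑ˡ-squeeze : ∀ {f g : A → ℕ} {xs} → (∀ x → g x ≤ f x) →
               ∑[ x ∈ xs ] f x ≤ ∑[ x ∈ xs ] g x → ∀ {x} → x ∈ xs → f x ≤ g x
  ∑ˡ-squeeze {f} {g} {y ∷ ys} g≤f ∑f≤∑g (here refl) =
    +-cancelʳ-≤ _ _ _ (≤-trans ∑f≤∑g (+-monoʳ-≤ (g y) (∑ˡ-mono-≤ g≤f ys)))
  ∑ˡ-squeeze {f} {g} {y ∷ ys} g≤f ∑f≤∑g (there x∈ys) =
    ∑ˡ-squeeze g≤f (+-cancelˡ-≤ (f y) _ _ (≤-trans ∑f≤∑g (+-monoˡ-≤ _ (g≤f y)))) x∈ys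

∑ˡ-comm : ∀ {A B : Set} (f : A → B → ℕ) xs ys →
          ∑[ x ∈ xs ] ∑[ y ∈ ys ] f x y ≡ ∑[ y ∈ ys ] ∑[ x ∈ xs ] f x y
∑ˡ-comm f []       ys = sym (∑ˡ-zero ys)
∑ˡ-comm f (x ∷ xs) ys = trans (cong (∑[ y ∈ ys ] f x y +_) (∑ˡ-comm f xs ys))
                              (sym (∑ˡ-distrib-+ (f x) _ ys))

module _ {A : Set} where

  countB-∷ : ∀ (p : A → Bool) x xs → countB p (x ∷ xs) ≡ 𝟙 (p x) + countB p xs
  countB-∷ p x xs with p x
  ... | true  = refl
  ... | false = refl

  countB≡∑𝟙 : ∀ (p : A → Bool) xs → countB p xs ≡ ∑[ x ∈ xs ] 𝟙 (p x)
  countB≡∑𝟙 p []       = refl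
  countB≡∑𝟙 p (x ∷ xs) = trans (countB-∷ p x xs) (cong (𝟙 (p x) +_) (countB≡∑𝟙 p xs))

  ∑-𝟙*≡countB* : ∀ (p : A → Bool) c xs → ∑[ x ∈ xs ] (𝟙 (p x) * c) ≡ countB p xs * c
  ∑-𝟙*≡countB* p c xs = trans (∑ˡ-*ʳ (𝟙 ∘ p) c xs) (cong (_* c) (sym (countB≡∑𝟙 p xs)))

  countB-cong : ∀ {p q : A → Bool} → (∀ x → p x ≡ q x) → ∀ xs → countB p xs ≡ countB q xs
  countB-cong {p} {q} p≗q xs =
    trans (countB≡∑𝟙 p xs) (trans (∑ˡ-cong (cong 𝟙 ∘ p≗q) xs) (sym (countB≡∑𝟙 q xs)))

  countB-mono : ∀ {p q : A → Bool} → (∀ x → T (p x) → T (q x)) → ∀ xs → countB p xs ≤ countB q xs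
  countB-mono {p} {q} p⇒q []       = z≤n
  countB-mono {p} {q} p⇒q (x ∷ xs) with p x | q x | p⇒q x
  ... | true  | true  | _   = s≤s (countB-mono p⇒q xs)
  ... | true  | false | p⇏q = ⊥-elim (p⇏q _)
  ... | false | true  | _   = m≤n⇒m≤1+n (countB-mono p⇒q xs)
  ... | false | false | _   = countB-mono p⇒q xs

  countB-zero : ∀ {p : A → Bool} → (∀ x → ¬ T (p x)) → ∀ xs → countB p xs ≡ 0
  countB-zero {p} ¬p []       = refl
  countB-zero {p} ¬p (x ∷ xs) with p x | ¬p x
  ... | true  | ¬px = ⊥-elim (¬px _)
  ... | false | _   = countB-zero ¬p xs

  countB-split : ∀ (r p : A → Bool) xs →
                 countB p xs ≡ countB (λ x → not (r x) ∧ p x) xs + countB (λ x → r x ∧ p x) xs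
  countB-split r p []       = refl
  countB-split r p (x ∷ xs) with r x | p x
  ... | false | false = countB-split r p xs
  ... | true  | false = countB-split r p xs
  ... | false | true  = cong suc (countB-split r p xs)
  ... | true  | true  = trans (cong suc (countB-split r p xs)) (sym (+-suc _ _))

  countB-++ : ∀ (p : A → Bool) xs ys → countB p (xs ++ ys) ≡ countB p xs + countB p ys
  countB-++ p []       ys = refl
  countB-++ p (x ∷ xs) ys with p x
  ... | true  = cong suc (countB-++ p xs ys)
  ... | false = countB-++ p xs ys

  countB-map : ∀ {B : Set} (p : B → Bool) (f : A → B) xs → countB p (map f xs) ≡ countB (p ∘ f) xs
  countB-map p f []       = refl
  countB-map p f (x ∷ xs) with p (f x)
  ... | true  = cong suc (countB-map p f xs)
  ... | false = countB-map p f xs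

  countB-disjoint : ∀ {p q : A → Bool} → (∀ x → T (p x) → ¬ T (q x)) →
                    ∀ xs → countB p xs + countB q xs ≤ length xs
  countB-disjoint {p} {q} p⇒¬q []       = z≤n
  countB-disjoint {p} {q} p⇒¬q (x ∷ xs) with p x | q x | p⇒¬q x
  ... | true  | true  | p⇒¬qx = ⊥-elim (p⇒¬qx _ _)
  ... | true  | false | _     = s≤s (countB-disjoint p⇒¬q xs)
  ... | false | true  | _     = ≤-trans (≤-reflexive (+-suc _ _)) (s≤s (countB-disjoint p⇒¬q xs))
  ... | false | false | _     = m≤n⇒m≤1+n (countB-disjoint p⇒¬q xs)

  countB-true : ∀ xs → countB (λ (_ : A) → true) xs ≡ length xs
  countB-true []       = refl
  countB-true (x ∷ xs) = cong suc (countB-true xs)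

  countB-pos⇒∃ : ∀ {p : A → Bool} xs → 1 ≤ countB p xs → ∃[ x ] T (p x)
  countB-pos⇒∃ {p} (x ∷ xs) h with p x in px
  ... | true  = x , subst T (sym px) _
  ... | false = countB-pos⇒∃ xs h

  ∈⇒1≤countB : ∀ (p : A → Bool) {x xs} → x ∈ xs → T (p x) → 1 ≤ countB p xs
  ∈⇒1≤countB p {x} {xs} x∈xs px = begin
    1                     ≡⟨ 𝟙-T px ⟨
    𝟙 (p x)               ≤⟨ ∈⇒≤∑ˡ (𝟙 ∘ p) x∈xs ⟩
    ∑[ y ∈ xs ] 𝟙 (p y)   ≡⟨ countB≡∑𝟙 p xs ⟨
    countB p xs           ∎
    where open ≤-Reasoning

  ∈⇒2≤countB-∷ : ∀ (p : A → Bool) {x y xs} → T (p x) → y ∈ xs → T (p y) → 2 ≤ countB p (x ∷ xs)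
  ∈⇒2≤countB-∷ p {x} {y} {xs} px y∈xs py = begin
    2                        ≤⟨ +-mono-≤ (≤-reflexive (sym (𝟙-T px))) (∈⇒1≤countB p y∈xs py) ⟩
    𝟙 (p x) + countB p xs    ≡⟨ countB-∷ p x xs ⟨
    countB p (x ∷ xs)        ∎
    where open ≤-Reasoning

  countB≤1⇒unique : ∀ (p : A → Bool) {xs} → countB p xs ≤ 1 →
                    ∀ {x y} → x ∈ xs → y ∈ xs → T (p x) → T (p y) → x ≡ y
  countB≤1⇒unique p c≤1 (here refl)  (here refl)  _  _  = refl
  countB≤1⇒unique p c≤1 (here refl)  (there y∈zs) px py =
    ⊥-elim (<⇒≱ (∈⇒2≤countB-∷ p px y∈zs py) c≤1)
  countB≤1⇒unique p c≤1 (there x∈zs) (here refl)  px py =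
    ⊥-elim (<⇒≱ (∈⇒2≤countB-∷ p py x∈zs px) c≤1)
  countB≤1⇒unique p {z ∷ zs} c≤1 (there x∈zs) (there y∈zs) px py =
    countB≤1⇒unique p (≤-trans (m≤n+m _ (𝟙 (p z))) (≤-trans (≤-reflexive (sym (countB-∷ p z zs))) c≤1))
                    x∈zs y∈zs px py

  𝟙-*-countB : ∀ b (q : A → Bool) xs → 𝟙 b * countB q xs ≡ countB (λ x → b ∧ q x) xs
  𝟙-*-countB true  q xs = +-identityʳ _
  𝟙-*-countB false q xs = sym (countB-zero (λ _ ()) xs)

  countB-*-≤-∑ˡ : ∀ {p : A → Bool} {f : A → ℕ} {c} xs →
                  All (λ x → T (p x) → c ≤ f x) xs → countB p xs * c ≤ ∑[ x ∈ xs ] f x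
  countB-*-≤-∑ˡ {p} [] [] = z≤n
  countB-*-≤-∑ˡ {p} (x ∷ xs) (c≤fx ∷ h) with p x
  ... | true  = +-mono-≤ (c≤fx _) (countB-*-≤-∑ˡ xs h)
  ... | false = ≤-trans (countB-*-≤-∑ˡ xs h) (m≤n+m _ _)

  ∑-weights-≥ : ∀ {p q : A → Bool} {w : A → ℕ} {c} →
    (∀ x → T (p x) → ¬ T (q x) → c ≤ w x) → ∀ xs →
    countB p xs * c ≤ ∑[ x ∈ xs ] (𝟙 (p x) * w x) + countB (λ x → p x ∧ q x) xs * c
  ∑-weights-≥ {p} {q} {w} {c} below xs = begin
    countB p xs * c
      ≡⟨ ∑-𝟙*≡countB* p c xs ⟨
    ∑[ x ∈ xs ] (𝟙 (p x) * c)
      ≤⟨ ∑ˡ-mono-≤ pointwise xs ⟩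
    ∑[ x ∈ xs ] (𝟙 (p x) * w x + 𝟙 (p x ∧ q x) * c)
      ≡⟨ ∑ˡ-distrib-+ _ _ xs ⟩
    ∑[ x ∈ xs ] (𝟙 (p x) * w x) + ∑[ x ∈ xs ] (𝟙 (p x ∧ q x) * c)
      ≡⟨ cong (∑[ x ∈ xs ] (𝟙 (p x) * w x) +_) (∑-𝟙*≡countB* _ c xs) ⟩
    ∑[ x ∈ xs ] (𝟙 (p x) * w x) + countB (λ x → p x ∧ q x) xs * c ∎
    where
      open ≤-Reasoning
      pointwise : ∀ x → 𝟙 (p x) * c ≤ 𝟙 (p x) * w x + 𝟙 (p x ∧ q x) * c
      pointwise x with p x | q x | below x
      ... | false | _     | _   = z≤n
      ... | true  | true  | _   = m≤n+m _ (w x + 0)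
      ... | true  | false | c≤w = ≤-trans (+-monoˡ-≤ 0 (c≤w _ (λ ()))) (m≤m+n (w x + 0) 0)

  ∑-weights-≤ : ∀ {p q : A → Bool} {w : A → ℕ} {b c} →
    (∀ x → T (p x) → w x ≤ b) → (∀ x → T (p x) → ¬ T (q x) → w x ≤ c) → ∀ xs →
    ∑[ x ∈ xs ] (𝟙 (p x) * w x) ≤ countB p xs * c + countB (λ x → p x ∧ q x) xs * b
  ∑-weights-≤ {p} {q} {w} {b} {c} bounded below xs = begin
    ∑[ x ∈ xs ] (𝟙 (p x) * w x)
      ≤⟨ ∑ˡ-mono-≤ pointwise xs ⟩
    ∑[ x ∈ xs ] (𝟙 (p x) * c + 𝟙 (p x ∧ q x) * b)
      ≡⟨ ∑ˡ-distrib-+ _ _ xs ⟩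
    ∑[ x ∈ xs ] (𝟙 (p x) * c) + ∑[ x ∈ xs ] (𝟙 (p x ∧ q x) * b)
      ≡⟨ cong₂ _+_ (∑-𝟙*≡countB* p c xs) (∑-𝟙*≡countB* _ b xs) ⟩
    countB p xs * c + countB (λ x → p x ∧ q x) xs * b ∎
    where
      open ≤-Reasoning
      pointwise : ∀ x → 𝟙 (p x) * w x ≤ 𝟙 (p x) * c + 𝟙 (p x ∧ q x) * b
      pointwise x with p x | q x | bounded x | below x
      ... | false | _     | _   | _   = z≤n
      ... | true  | true  | w≤b | _   = ≤-trans (+-monoˡ-≤ 0 (w≤b _)) (m≤n+m (b + 0) (c + 0))
      ... | true  | false | _   | w≤c = ≤-trans (+-monoˡ-≤ 0 (w≤c _ (λ ()))) (m≤m+n _ _)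

  T-allB⁻ : ∀ {p : A → Bool} {xs} → T (allB p xs) → ∀ {x} → x ∈ xs → T (p x)
  T-allB⁻ {p} {y ∷ ys} h (here refl) = proj₁ (T-∧-elim h)
  T-allB⁻ {p} {y ∷ ys} h (there x∈)  = T-allB⁻ (proj₂ (T-∧-elim {p y} h)) x∈

  T-allB⁺ : ∀ {p : A → Bool} → (∀ x → T (p x)) → ∀ xs → T (allB p xs)
  T-allB⁺ h []       = _
  T-allB⁺ h (x ∷ xs) = T-∧-intro (h x) (T-allB⁺ h xs)

  allB-cong : ∀ {p q : A → Bool} → (∀ x → p x ≡ q x) → ∀ xs → allB p xs ≡ allB q xs
  allB-cong p≗q []       = refl
  allB-cong p≗q (x ∷ xs) = cong₂ _∧_ (p≗q x) (allB-cong p≗q xs)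

  T-anyB⁻ : ∀ {p : A → Bool} xs → T (anyB p xs) → ∃[ x ] T (p x)
  T-anyB⁻ {p} (x ∷ xs) h with p x in px
  ... | true  = x , subst T (sym px) _
  ... | false = T-anyB⁻ xs h

countB-comm : ∀ {A B : Set} (r : A → B → Bool) xs ys →
              ∑[ x ∈ xs ] countB (r x) ys ≡ ∑[ y ∈ ys ] countB (λ x → r x y) xs
countB-comm r xs ys = begin
  ∑[ x ∈ xs ] countB (r x) ys          ≡⟨ ∑ˡ-cong (λ x → countB≡∑𝟙 (r x) ys) xs ⟩
  ∑[ x ∈ xs ] ∑[ y ∈ ys ] 𝟙 (r x y)    ≡⟨ ∑ˡ-comm _ xs ys ⟩
  ∑[ y ∈ ys ] ∑[ x ∈ xs ] 𝟙 (r x y)    ≡⟨ ∑ˡ-cong (λ y → countB≡∑𝟙 (λ x → r x y) xs) ys ⟨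
  ∑[ y ∈ ys ] countB (λ x → r x y) xs  ∎
  where open ≡-Reasoning

module _ {A : Set} where

  ∑∑ : List A → (A → A → Bool) → ℕ
  ∑∑ xs r = ∑[ v ∈ xs ] ∑[ u ∈ xs ] 𝟙 (r u v)

  ∑∑-trichotomy : ∀ (r : A → A → Bool) (a : A → ℕ) xs →
    ∑∑ xs r ≡ ∑∑ xs (λ u v → r u v ∧ (a u <ᵇ a v)) + ∑∑ xs (λ u v → r u v ∧ (a v <ᵇ a u))
              + ∑∑ xs (λ u v → r u v ∧ (a u ≡ᵇ a v))
  ∑∑-trichotomy r a xs =
    trans (∑ˡ-cong (λ v → trans (∑ˡ-cong (λ u → 𝟙-trichotomy (r u v) (a u) (a v)) xs) (distrib³ xs)) xs)
          (distrib³ xs)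
    where
      distrib³ : ∀ {f g h : A → ℕ} xs →
                 ∑[ x ∈ xs ] (f x + g x + h x) ≡ ∑[ x ∈ xs ] f x + ∑[ x ∈ xs ] g x + ∑[ x ∈ xs ] h x
      distrib³ xs = trans (∑ˡ-distrib-+ _ _ xs) (cong (_+ _) (∑ˡ-distrib-+ _ _ xs))

  ∑∑-transpose : ∀ {r : A → A → Bool} → (∀ u v → r u v ≡ r v u) → ∀ (a : A → ℕ) xs →
    ∑∑ xs (λ u v → r u v ∧ (a v <ᵇ a u)) ≡ ∑∑ xs (λ u v → r u v ∧ (a u <ᵇ a v))
  ∑∑-transpose r-sym a xs = trans (∑ˡ-comm _ xs xs)
    (∑ˡ-cong (λ v → ∑ˡ-cong (λ u → cong (λ b → 𝟙 (b ∧ (a u <ᵇ a v))) (r-sym v u)) xs) xs)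

-- Vertex sets

countB-allFin-suc : ∀ {n} (p : Fin (suc n) → Bool) →
                    countB p (allFin (suc n)) ≡ 𝟙 (p zero) + countB (p ∘ suc) (allFin n)
countB-allFin-suc {n} p = trans (countB-∷ p zero (tabulate suc)) (cong (𝟙 (p zero) +_)
  (trans (cong (countB p) (sym (map-tabulate (λ i → i) suc))) (countB-map p suc (allFin n))))

countB-allFin-== : ∀ {n} (p : Fin n → Bool) v → countB (λ u → (u == v) ∧ p u) (allFin n) ≡ 𝟙 (p v)
countB-allFin-== {suc n} p zero = begin
  countB (λ u → (u == zero) ∧ p u) (allFin (suc n))
    ≡⟨ countB-allFin-suc (λ u → (u == zero) ∧ p u) ⟩
  𝟙 (p zero) + countB (λ _ → false) (allFin n)
    ≡⟨ cong (𝟙 (p zero) +_) (countB-zero (λ _ ()) (allFin n)) ⟩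
  𝟙 (p zero) + 0
    ≡⟨ +-identityʳ _ ⟩
  𝟙 (p zero) ∎
  where open ≡-Reasoning
countB-allFin-== p (suc v) =
  trans (countB-allFin-suc (λ u → (u == suc v) ∧ p u)) (countB-allFin-== (p ∘ suc) v)

countB-allFin-≤1 : ∀ {n} (p : Fin n → Bool) → (∀ u w → T (p u) → T (p w) → u ≡ w) →
                   countB p (allFin n) ≤ 1
countB-allFin-≤1 {zero}  p unique = z≤n
countB-allFin-≤1 {suc n} p unique rewrite countB-allFin-suc p with p zero in p0
... | true  = ≤-reflexive (cong suc (countB-zero (λ i → 0≢1+ ∘ unique zero (suc i) (subst T (sym p0) _)) (allFin n)))
  where
    0≢1+ : ∀ {i : Fin n} → zero ≢ suc i
    0≢1+ ()
... | false = countB-allFin-≤1 (p ∘ suc) (λ u w pu pw → Fin-suc-injective (unique (suc u) (suc w) pu pw))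

size-full : ∀ n → size {n} (λ _ → true) ≡ n
size-full n = trans (countB-true (allFin n)) (length-tabulate (λ i → i))

nonRoots : ∀ n → countB (λ v → not (toℕ {n} v ≡ᵇ 0)) (allFin n) ≡ n ∸ 1
nonRoots zero    = refl
nonRoots (suc n) = trans (countB-allFin-suc {n} (λ v → not (toℕ v ≡ᵇ 0))) (size-full n)

-- The members of allVSets are built from pattern-matching lambdas, so counts over it can only
-- be rearranged for predicates that respect pointwise equality.
Extensional : ∀ {n} {B : Set} → (VSet n → B) → Set
Extensional {n} f = ∀ {I J : VSet n} → I ≗ J → f I ≡ f J

∷ᵛ-cong : ∀ {n} b {I J : VSet n} → I ≗ J → b ∷ᵛ I ≗ b ∷ᵛ J
∷ᵛ-cong b I≗J zero    = refl
∷ᵛ-cong b I≗J (suc i) = I≗J i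

insert-cong : ∀ {n} (v : Fin n) {I J : VSet n} → I ≗ J → insert v I ≗ insert v J
insert-cong v I≗J u = cong (_∨ (u == v)) (I≗J u)

size-ext : ∀ {n} → Extensional (size {n})
size-ext I≗J = countB-cong I≗J (allFin _)

countB-allVSets-suc : ∀ {n} (p : VSet (suc n) → Bool) → Extensional p →
  countB p (allVSets (suc n)) ≡
  countB (λ I → p (true ∷ᵛ I)) (allVSets n) + countB (λ I → p (false ∷ᵛ I)) (allVSets n)
countB-allVSets-suc {n} p p-ext =
  trans (countB-++ p (map _ (allVSets n)) _)
        (cong₂ _+_ (via-map true λ _ → λ { zero → refl ; (suc _) → refl })
                   (trans (countB-++ p (map _ (allVSets n)) [])
                          (trans (+-identityʳ _) (via-map false λ _ → λ { zero → refl ; (suc _) → refl }))))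
  where
    via-map : ∀ b {g : VSet n → VSet (suc n)} → (∀ I → g I ≗ b ∷ᵛ I) →
              countB p (map g (allVSets n)) ≡ countB (λ I → p (b ∷ᵛ I)) (allVSets n)
    via-map b g≗ = trans (countB-map p _ (allVSets n)) (countB-cong (λ I → p-ext (g≗ I)) (allVSets n))

countB-allVSets-pos : ∀ {n} (q : VSet n → Bool) → Extensional q →
                      ∀ I → T (q I) → 1 ≤ countB q (allVSets n)
countB-allVSets-pos {zero} q q-ext I qI =
  ∈⇒1≤countB q {xs = allVSets 0} (here refl) (subst T (q-ext (λ ())) qI)
countB-allVSets-pos {suc n} q q-ext I qI = begin
  1                                            ≤⟨ countB-allVSets-pos _ (q-ext ∘ ∷ᵛ-cong (I zero)) (I ∘ suc)
                                                    (subst T (q-ext head∷tail) qI) ⟩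
  countB (λ J → q (I zero ∷ᵛ J)) (allVSets n)  ≤⟨ one-summand (I zero) ⟩
  countB (λ J → q (true ∷ᵛ J)) (allVSets n) +
  countB (λ J → q (false ∷ᵛ J)) (allVSets n)   ≡⟨ countB-allVSets-suc q q-ext ⟨
  countB q (allVSets (suc n))                  ∎
  where
    open ≤-Reasoning
    head∷tail : I ≗ I zero ∷ᵛ (I ∘ suc)
    head∷tail zero    = refl
    head∷tail (suc i) = refl
    one-summand : ∀ b → countB (λ J → q (b ∷ᵛ J)) (allVSets n) ≤
                        countB (λ J → q (true ∷ᵛ J)) (allVSets n) +
                        countB (λ J → q (false ∷ᵛ J)) (allVSets n)
    one-summand true  = m≤m+n _ _
    one-summand false = m≤n+m _ _

countB-insert : ∀ {n} (q : VSet n → Bool) → Extensional q → ∀ v →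
  countB (λ I → I v ∧ q I) (allVSets n) ≡ countB (λ I → not (I v) ∧ q (insert v I)) (allVSets n)
countB-insert {suc n} q q-ext v =
  trans (countB-allVSets-suc _ (λ I≗J → cong₂ _∧_ (I≗J v) (q-ext I≗J)))
        (trans (split v) (sym (countB-allVSets-suc _ (λ I≗J →
                                 cong₂ (λ a b → not a ∧ b) (I≗J v) (q-ext (insert-cong v I≗J))))))
  where
    split : ∀ v →
      countB (λ I → (true ∷ᵛ I) v ∧ q (true ∷ᵛ I)) (allVSets n) +
      countB (λ I → (false ∷ᵛ I) v ∧ q (false ∷ᵛ I)) (allVSets n) ≡
      countB (λ I → not ((true ∷ᵛ I) v) ∧ q (insert v (true ∷ᵛ I))) (allVSets n) +
      countB (λ I → not ((false ∷ᵛ I) v) ∧ q (insert v (false ∷ᵛ I))) (allVSets n)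
    split zero = trans (+-comm (countB (λ I → q (true ∷ᵛ I)) (allVSets n)) _)
                       (cong (countB (λ _ → false) (allVSets n) +_)
                             (countB-cong (λ I → q-ext (insert-zero I)) (allVSets n)))
      where
        insert-zero : ∀ I → true ∷ᵛ I ≗ insert zero (false ∷ᵛ I)
        insert-zero I zero    = refl
        insert-zero I (suc i) = sym (∨-identityʳ (I i))
    split (suc v) = cong₂ _+_ (step true) (step false)
      where
        insert-suc : ∀ b I → b ∷ᵛ insert v I ≗ insert (suc v) (b ∷ᵛ I)
        insert-suc b I zero    = sym (∨-identityʳ b)
        insert-suc b I (suc i) = refl
        step : ∀ b → countB (λ I → I v ∧ q (b ∷ᵛ I)) (allVSets n) ≡
                     countB (λ I → not (I v) ∧ q (insert (suc v) (b ∷ᵛ I))) (allVSets n)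
        step b = trans (countB-insert (λ I → q (b ∷ᵛ I)) (q-ext ∘ ∷ᵛ-cong b) v)
                       (countB-cong (λ I → cong (not (I v) ∧_) (q-ext (insert-suc b I))) (allVSets n))

_─_ : ∀ {n} → VSet n → Fin n → VSet n
(S ─ v) u = not (u == v) ∧ S u

─⁻ : ∀ {n} (S : VSet n) v {u} → T ((S ─ v) u) → T (S u) × u ≢ v
─⁻ S v {u} h with T-∧-elim h
... | u≠v , Su = Su , λ { refl → T-not⇒¬T u≠v (==-refl u) }

size-─ : ∀ {n} (S : VSet n) v → size S ≡ 𝟙 (S v) + size (S ─ v)
size-─ S v = trans (countB-split (_== v) S (allFin _))
                   (trans (+-comm (size (S ─ v)) _) (cong (_+ size (S ─ v)) (countB-allFin-== S v)))

size-insert : ∀ {n} (I : VSet n) v → ¬ T (I v) → size (insert v I) ≡ suc (size I)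
size-insert I v ¬Iv = begin
  size (insert v I)
    ≡⟨ size-─ (insert v I) v ⟩
  𝟙 (I v ∨ (v == v)) + size (insert v I ─ v)
    ≡⟨ cong₂ _+_ (𝟙-T (T-∨-introʳ (I v) (==-refl v))) (size-ext insert─≗) ⟩
  suc (size (I ─ v))
    ≡⟨ cong (λ b → suc (b + size (I ─ v))) (𝟙-¬T ¬Iv) ⟨
  suc (𝟙 (I v) + size (I ─ v))
    ≡⟨ cong suc (size-─ I v) ⟨
  suc (size I) ∎
  where
    open ≡-Reasoning
    insert─≗ : insert v I ─ v ≗ I ─ v
    insert─≗ u with u == v
    ... | true  = refl
    ... | false = ∨-identityʳ (I u)

-- Independent sets and their extensions

Adjacent : ∀ {n} → Graph n → Fin n → Fin n → Set
Adjacent G i j = T (G i j)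

Independent : ∀ {n} → Graph n → VSet n → Set
Independent G I = ∀ i j → T (I i) → T (I j) → ¬ Adjacent G i j

independentB⇒Independent : ∀ {n} {G : Graph n} {I} → T (independentB G I) → Independent G I
independentB⇒Independent {G = G} {I} h i j =
  excluded (I i) (I j) (G i j) (T-allB⁻ (T-allB⁻ h (∈-allFin i)) (∈-allFin j))
  where
    excluded : ∀ a b c → T (not (a ∧ b ∧ c)) → T a → T b → ¬ T c
    excluded true true true () _ _ _

Independent⇒independentB : ∀ {n} {G : Graph n} {I} → Independent G I → T (independentB G I)
Independent⇒independentB {G = G} {I} indep = T-allB⁺ (λ i → T-allB⁺ (λ j → allowed i j) (allFin _)) (allFin _)
  where
    allowed : ∀ i j → T (not (I i ∧ I j ∧ G i j))
    allowed i j with I i in Ii | I j in Ij | G i j in Gij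
    ... | false | _     | _     = _
    ... | true  | false | _     = _
    ... | true  | true  | false = _
    ... | true  | true  | true  = indep i j (subst T (sym Ii) _) (subst T (sym Ij) _) (subst T (sym Gij) _)

independentB-ext : ∀ {n} (G : Graph n) → Extensional (independentB G)
independentB-ext G I≗J = allB-cong (λ i → allB-cong (λ j →
  cong₂ (λ a b → not (a ∧ b ∧ G i j)) (I≗J i) (I≗J j)) (allFin _)) (allFin _)

independentB-insert⇒ : ∀ {n} {G : Graph n} {I} v → T (independentB G (insert v I)) → T (independentB G I)
independentB-insert⇒ {G = G} {I} v h = Independent⇒independentB {G = G} {I} λ i j Ii Ij →
  independentB⇒Independent {G = G} {insert v I} h i j (T-∨-introˡ (i == v) Ii) (T-∨-introˡ (j == v) Ij)

indepOfSize : ∀ {n} → Graph n → ℕ → VSet n → Bool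
indepOfSize G k I = independentB G I ∧ (size I ≡ᵇ k)

indepOfSize-ext : ∀ {n} (G : Graph n) k → Extensional (indepOfSize G k)
indepOfSize-ext G k I≗J = cong₂ (λ a s → a ∧ (s ≡ᵇ k)) (independentB-ext G I≗J) (size-ext I≗J)

indepOfSize-insert : ∀ {n} (G : Graph n) k I v →
  indepOfSize G k I ∧ (not (I v) ∧ independentB G (insert v I)) ≡ not (I v) ∧ indepOfSize G (suc k) (insert v I)
indepOfSize-insert G k I v with I v in Iv
... | true  = ∧-zeroʳ (indepOfSize G k I)
... | false rewrite size-insert I v (subst T Iv) with independentB G (insert v I) in indep+v
...   | false = ∧-zeroʳ (indepOfSize G k I)
...   | true rewrite Equivalence.to T-≡ (independentB-insert⇒ {G = G} {I} v (subst T (sym indep+v) _)) =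
  ∧-identityʳ _

∑-ext≡indepCount-suc : ∀ {n} (G : Graph n) k →
  ∑[ I ∈ allVSets n ] (𝟙 (indepOfSize G k I) * ext G I) ≡ indepCount G (suc k) * suc k
∑-ext≡indepCount-suc {n} G k = begin
  ∑[ I ∈ Is ] (𝟙 (P k I) * ext G I)
    ≡⟨ ∑ˡ-cong (λ I → 𝟙-*-countB (P k I) _ V) Is ⟩
  ∑[ I ∈ Is ] countB (λ v → P k I ∧ (not (I v) ∧ independentB G (insert v I))) V
    ≡⟨ ∑ˡ-cong (λ I → countB-cong (indepOfSize-insert G k I) V) Is ⟩
  ∑[ I ∈ Is ] countB (λ v → not (I v) ∧ P (suc k) (insert v I)) V
    ≡⟨ countB-comm (λ I v → not (I v) ∧ P (suc k) (insert v I)) Is V ⟩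
  ∑[ v ∈ V ] countB (λ I → not (I v) ∧ P (suc k) (insert v I)) Is
    ≡⟨ ∑ˡ-cong (countB-insert (P (suc k)) (indepOfSize-ext G (suc k))) V ⟨
  ∑[ v ∈ V ] countB (λ I → I v ∧ P (suc k) I) Is
    ≡⟨ countB-comm (λ I v → I v ∧ P (suc k) I) Is V ⟨
  ∑[ I ∈ Is ] countB (λ v → I v ∧ P (suc k) I) V
    ≡⟨ ∑ˡ-cong members Is ⟩
  ∑[ I ∈ Is ] (𝟙 (P (suc k) I) * suc k)
    ≡⟨ ∑-𝟙*≡countB* (P (suc k)) (suc k) Is ⟩
  indepCount G (suc k) * suc k ∎
  where
    open ≡-Reasoning
    Is : List (VSet n)
    Is = allVSets n
    V : List (Fin n)
    V = allFin n
    P : ℕ → VSet n → Bool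
    P = indepOfSize G
    members : ∀ I → countB (λ v → I v ∧ P (suc k) I) V ≡ 𝟙 (P (suc k) I) * suc k
    members I with P (suc k) I in PI
    ... | false = countB-zero (λ v h → subst T (∧-zeroʳ (I v)) h) V
    ... | true  = trans (countB-cong (λ v → ∧-identityʳ (I v)) V)
                        (trans (≡ᵇ⇒≡ (size I) (suc k) (proj₂ (T-∧-elim {independentB G I} (subst T (sym PI) _))))
                               (sym (+-identityʳ _)))

ext+size≤n : ∀ {n} (G : Graph n) I → ext G I + size I ≤ n
ext+size≤n {n} G I = subst (ext G I + size I ≤_) (length-tabulate (λ i → i))
  (countB-disjoint (λ v h → T-not⇒¬T (proj₁ (T-∧-elim h))) (allFin n))

lowExtCount : ∀ {n} → Graph n → ℕ → ℕ
lowExtCount {n} G k = countB (λ I → independentB G I ∧ (size I ≡ᵇ k) ∧ (ext G I ≤ᵇ suc k)) (allVSets n)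

highExtCount : ∀ {n} → Graph n → ℕ → ℕ
highExtCount {n} G k = countB (λ I → independentB G I ∧ (size I ≡ᵇ k) ∧ (suc k ≤ᵇ ext G I)) (allVSets n)

indepCount-≤-lowExtCount : ∀ {n} (G : Graph n) k →
  indepCount G k * (2 + k) ≤ indepCount G (suc k) * suc k + lowExtCount G k * (2 + k)
indepCount-≤-lowExtCount {n} G k = begin
  indepCount G k * (2 + k)
    ≤⟨ ∑-weights-≥ (λ I _ ¬low → ¬T-≤ᵇ⇒> ¬low) (allVSets n) ⟩
  ∑[ I ∈ allVSets n ] (𝟙 (indepOfSize G k I) * ext G I) +
  countB (λ I → indepOfSize G k I ∧ (ext G I ≤ᵇ suc k)) (allVSets n) * (2 + k)
    ≡⟨ cong₂ (λ a b → a + b * (2 + k)) (∑-ext≡indepCount-suc G k)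
             (countB-cong (λ I → ∧-assoc (independentB G I) _ _) (allVSets n)) ⟩
  indepCount G (suc k) * suc k + lowExtCount G k * (2 + k) ∎
  where open ≤-Reasoning

indepCount-≤-highExtCount : ∀ {n} (G : Graph n) k →
  indepCount G (suc k) * suc k ≤ indepCount G k * k + highExtCount G k * (n ∸ k)
indepCount-≤-highExtCount {n} G k = begin
  indepCount G (suc k) * suc k
    ≡⟨ ∑-ext≡indepCount-suc G k ⟨
  ∑[ I ∈ allVSets n ] (𝟙 (indepOfSize G k I) * ext G I)
    ≤⟨ ∑-weights-≤ ext≤n∸k (λ I _ ¬high → s≤s⁻¹ (¬T-≤ᵇ⇒> ¬high)) (allVSets n) ⟩
  indepCount G k * k + countB (λ I → indepOfSize G k I ∧ (suc k ≤ᵇ ext G I)) (allVSets n) * (n ∸ k)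
    ≡⟨ cong (λ c → indepCount G k * k + c * (n ∸ k))
            (countB-cong (λ I → ∧-assoc (independentB G I) _ _) (allVSets n)) ⟩
  indepCount G k * k + highExtCount G k * (n ∸ k) ∎
  where
    open ≤-Reasoning
    ext≤n∸k : ∀ I → T (indepOfSize G k I) → ext G I ≤ n ∸ k
    ext≤n∸k I h = begin
      ext G I                    ≡⟨ m+n∸n≡m (ext G I) (size I) ⟨
      ext G I + size I ∸ size I  ≤⟨ ∸-monoˡ-≤ (size I) (ext+size≤n G I) ⟩
      n ∸ size I                 ≡⟨ cong (n ∸_) |I|≡k ⟩
      n ∸ k                      ∎
      where
        |I|≡k : size I ≡ k
        |I|≡k = ≡ᵇ⇒≡ (size I) k (proj₂ (T-∧-elim {independentB G I} h))

-- Independent sets in forests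

C-monoˡ-≤ : ∀ k {m n} → m ≤ n → m C k ≤ n C k
C-monoˡ-≤ k {n = zero}  z≤n = ≤-refl
C-monoˡ-≤ k {m} {suc n} m≤1+n with m≤n⇒m<n∨m≡n m≤1+n
... | inj₂ refl  = ≤-refl
... | inj₁ m<1+n = ≤-trans (C-monoˡ-≤ k (s≤s⁻¹ m<1+n)) (nCk≤[1+n]Ck k)
  where
    nCk≤[1+n]Ck : ∀ k → n C k ≤ suc n C k
    nCk≤[1+n]Ck zero    = ≤-refl
    nCk≤[1+n]Ck (suc k) = ≤-trans (m≤n+m _ (n C k)) (≤-reflexive (nCk+nC[k+1]≡[n+1]C[k+1] n k))

[1+s∸j]C[1+j]≤ : ∀ s j → (suc s ∸ j) C suc j ≤ (s ∸ j) C suc j + (s ∸ j) C j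
[1+s∸j]C[1+j]≤ s j with j ≤? s
... | yes j≤s rewrite +-∸-assoc 1 j≤s =
  ≤-reflexive (trans (sym (nCk+nC[k+1]≡[n+1]C[k+1] (s ∸ j) j)) (+-comm ((s ∸ j) C j) _))
... | no  j≰s rewrite m≤n⇒m∸n≡0 (≰⇒> j≰s) = z≤n

OneDegenerate : ∀ {n} → Graph n → Set
OneDegenerate {n} G = ∀ (S : VSet n) {v₀} → T (S v₀) →
  ∃[ v ] T (S v) × (∀ {u w} → T (S u) → T (S w) → Adjacent G u v → Adjacent G w v → u ≡ w)

_⊆ᵇ_ : ∀ {n} → VSet n → VSet n → Bool
I ⊆ᵇ S = allB (λ u → not (I u) ∨ S u) (allFin _)

indepSubsetOfSize : ∀ {n} → Graph n → VSet n → ℕ → VSet n → Bool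
indepSubsetOfSize G S j I = indepOfSize G j I ∧ (I ⊆ᵇ S)

indepSubsetCount : ∀ {n} → Graph n → VSet n → ℕ → ℕ
indepSubsetCount {n} G S j = countB (indepSubsetOfSize G S j) (allVSets n)

module _ {n} {G : Graph n} {S : VSet n} {j : ℕ} where

  indepSubsetOfSize⁺ : ∀ {I} → Independent G I → size I ≡ j → (∀ u → T (I u) → T (S u)) →
                       T (indepSubsetOfSize G S j I)
  indepSubsetOfSize⁺ {I} indep |I|≡j I⊆S =
    T-∧-intro (T-∧-intro (Independent⇒independentB indep) (≡⇒≡ᵇ (size I) j |I|≡j))
              (T-allB⁺ (λ u → ⊆-at u (I⊆S u)) (allFin n))
    where
      ⊆-at : ∀ u → (T (I u) → T (S u)) → T (not (I u) ∨ S u)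
      ⊆-at u I⇒S with I u
      ... | false = _
      ... | true  = I⇒S _

  indepSubsetOfSize⁻ : ∀ {I} → T (indepSubsetOfSize G S j I) →
                       Independent G I × size I ≡ j × (∀ u → T (I u) → T (S u))
  indepSubsetOfSize⁻ {I} h with T-∧-elim {indepOfSize G j I} h
  ... | ofSize , I⊆S with T-∧-elim {independentB G I} ofSize
  ...   | indep , |I|≡j = independentB⇒Independent indep , ≡ᵇ⇒≡ (size I) j |I|≡j ,
                          λ u → ⊆-at u (T-allB⁻ I⊆S (∈-allFin u))
    where
      ⊆-at : ∀ u → T (not (I u) ∨ S u) → T (I u) → T (S u)
      ⊆-at u h Iu with I u
      ... | true = h

  indepSubsetOfSize-ext : Extensional (indepSubsetOfSize G S j)
  indepSubsetOfSize-ext I≗J =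
    cong₂ _∧_ (indepOfSize-ext G j I≗J) (allB-cong (λ u → cong (λ b → not b ∨ S u) (I≗J u)) (allFin n))

dropClosedNbhd : ∀ {n} → Graph n → Fin n → VSet n → VSet n
dropClosedNbhd G v S u = not (G u v) ∧ (S ─ v) u

-- Pascal's rule: split the subsets of S by whether they contain v; those that do are
-- I ∪ {v} with I ⊆ S ∖ N[v].
indepSubsetCount-step : ∀ {n} {G : Graph n} → Symmetric (Adjacent G) → Irreflexive _≡_ (Adjacent G) →
  ∀ S j {v} → T (S v) →
  indepSubsetCount G (S ─ v) (suc j) + indepSubsetCount G (dropClosedNbhd G v S) j ≤ indepSubsetCount G S (suc j)
indepSubsetCount-step {n} {G} G-sym G-irr S j {v} Sv = begin
  indepSubsetCount G (S ─ v) (suc j) + indepSubsetCount G (dropClosedNbhd G v S) j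
    ≤⟨ +-mono-≤ (countB-mono avoiding Is) (countB-mono extending Is) ⟩
  countB (λ I → not (I v) ∧ q I) Is + countB (λ I → not (I v) ∧ q (insert v I)) Is
    ≡⟨ cong (countB (λ I → not (I v) ∧ q I) Is +_) (countB-insert q indepSubsetOfSize-ext v) ⟨
  countB (λ I → not (I v) ∧ q I) Is + countB (λ I → I v ∧ q I) Is
    ≡⟨ countB-split (λ I → I v) q Is ⟨
  indepSubsetCount G S (suc j) ∎
  where
    open ≤-Reasoning
    Is : List (VSet n)
    Is = allVSets n
    q : VSet n → Bool
    q = indepSubsetOfSize G S (suc j)
    avoiding : ∀ I → T (indepSubsetOfSize G (S ─ v) (suc j) I) → T (not (I v) ∧ q I)
    avoiding I h with indepSubsetOfSize⁻ h
    ... | indep , |I|≡1+j , I⊆S─v =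
      T-∧-intro (¬T⇒T-not λ Iv → proj₂ (─⁻ S v (I⊆S─v v Iv)) refl)
                (indepSubsetOfSize⁺ indep |I|≡1+j (λ u Iu → proj₁ (─⁻ S v (I⊆S─v u Iu))))
    extending : ∀ I → T (indepSubsetOfSize G (dropClosedNbhd G v S) j I) → T (not (I v) ∧ q (insert v I))
    extending I h with indepSubsetOfSize⁻ h
    ... | indep , |I|≡j , I⊆far = T-∧-intro (¬T⇒T-not ¬Iv) (indepSubsetOfSize⁺ indep+v size+v ⊆S)
      where
        far : ∀ {u} → T (I u) → ¬ Adjacent G u v × T (S u) × u ≢ v
        far {u} Iu with T-∧-elim (I⊆far u Iu)
        ... | ¬Guv , S─v = T-not⇒¬T ¬Guv , ─⁻ S v S─v
        ¬Iv : ¬ T (I v)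
        ¬Iv Iv = proj₂ (proj₂ (far Iv)) refl
        size+v : size (insert v I) ≡ suc j
        size+v = trans (size-insert I v ¬Iv) (cong suc |I|≡j)
        ⊆S : ∀ u → T (insert v I u) → T (S u)
        ⊆S u h with T-∨-elim h
        ... | inj₁ Iu   = proj₁ (proj₂ (far Iu))
        ... | inj₂ u==v = subst (T ∘ S) (sym (==⇒≡ u==v)) Sv
        indep+v : Independent G (insert v I)
        indep+v i k hi hk Gik with T-∨-elim hi | T-∨-elim hk
        ... | inj₁ Ii   | inj₁ Ik   = indep i k Ii Ik Gik
        ... | inj₁ Ii   | inj₂ k==v = proj₁ (far Ii) (subst (Adjacent G i) (==⇒≡ k==v) Gik)
        ... | inj₂ i==v | inj₁ Ik   = proj₁ (far Ik) (G-sym (subst (λ x → Adjacent G x k) (==⇒≡ i==v) Gik))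
        ... | inj₂ i==v | inj₂ k==v = G-irr (trans (==⇒≡ i==v) (sym (==⇒≡ k==v))) Gik

size-dropClosedNbhd : ∀ {n} {G : Graph n} S v →
  (∀ {u w} → T (S u) → T (S w) → Adjacent G u v → Adjacent G w v → u ≡ w) →
  size (S ─ v) ≤ suc (size (dropClosedNbhd G v S))
size-dropClosedNbhd {n} {G} S v unique = begin
  size (S ─ v)
    ≡⟨ countB-split (λ u → G u v) (S ─ v) (allFin n) ⟩
  size (dropClosedNbhd G v S) + countB (λ u → G u v ∧ (S ─ v) u) (allFin n)
    ≤⟨ +-monoʳ-≤ _ (countB-allFin-≤1 _ neighbour-unique) ⟩
  size (dropClosedNbhd G v S) + 1
    ≡⟨ +-comm _ 1 ⟩
  suc (size (dropClosedNbhd G v S)) ∎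
  where
    open ≤-Reasoning
    neighbour-unique : ∀ u w → T (G u v ∧ (S ─ v) u) → T (G w v ∧ (S ─ v) w) → u ≡ w
    neighbour-unique u w hu hw with T-∧-elim hu | T-∧-elim hw
    ... | Guv , S─vu | Gwv , S─vw = unique (proj₁ (─⁻ S v S─vu)) (proj₁ (─⁻ S v S─vw)) Guv Gwv

indepSubsetCount-lowerBound : ∀ {n} {G : Graph n} → Symmetric (Adjacent G) → Irreflexive _≡_ (Adjacent G) →
  OneDegenerate G → ∀ s j S → s ≤ size S → (suc s ∸ j) C j ≤ indepSubsetCount G S j
indepSubsetCount-lowerBound {n} {G} G-sym G-irr G-deg = <-rec Bound bound
  where
    Bound : ℕ → Set
    Bound s = ∀ j S → s ≤ size S → (suc s ∸ j) C j ≤ indepSubsetCount G S j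
    bound : ∀ s → (∀ {t} → t < s → Bound t) → Bound s
    bound s rec zero S _ = countB-allVSets-pos (indepSubsetOfSize G S 0) (indepSubsetOfSize-ext {G = G})
      (λ _ → false) (indepSubsetOfSize⁺ {G = G} {S} (λ _ _ ()) (countB-zero (λ _ ()) (allFin n)) (λ _ ()))
    bound zero rec (suc j) S _ rewrite 0∸n≡0 j = z≤n
    bound (suc s) rec (suc j) S 1+s≤|S| with countB-pos⇒∃ (allFin n) (≤-trans (s≤s z≤n) 1+s≤|S|)
    ... | _ , Sv₀ with G-deg S Sv₀
    ... | v , Sv , unique = begin
      (suc s ∸ j) C suc j
        ≤⟨ [1+s∸j]C[1+j]≤ s j ⟩
      (s ∸ j) C suc j + (s ∸ j) C j
        ≤⟨ +-mono-≤ (rec ≤-refl (suc j) (S ─ v) s≤|S─v|)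
                    (≤-trans (C-monoˡ-≤ j (∸-monoˡ-≤ j (m≤1+pred[m] s)))
                             (rec (s≤s pred[n]≤n) j T₂ s-1≤|T₂|)) ⟩
      indepSubsetCount G (S ─ v) (suc j) + indepSubsetCount G T₂ j
        ≤⟨ indepSubsetCount-step G-sym G-irr S j Sv ⟩
      indepSubsetCount G S (suc j) ∎
      where
        open ≤-Reasoning
        T₂ : VSet n
        T₂ = dropClosedNbhd G v S
        m≤1+pred[m] : ∀ m → m ≤ suc (pred m)
        m≤1+pred[m] zero    = z≤n
        m≤1+pred[m] (suc m) = ≤-refl
        s≤|S─v| : s ≤ size (S ─ v)
        s≤|S─v| = s≤s⁻¹ (≤-trans 1+s≤|S| (≤-reflexive |S|≡1+|S─v|))
          where
            |S|≡1+|S─v| : size S ≡ suc (size (S ─ v))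
            |S|≡1+|S─v| = trans (size-─ S v) (cong (_+ size (S ─ v)) (𝟙-T Sv))
        s-1≤|T₂| : pred s ≤ size T₂
        s-1≤|T₂| = pred-mono-≤ (≤-trans s≤|S─v| (size-dropClosedNbhd {G = G} S v unique))

indepCount-lowerBound : ∀ {n} {G : Graph n} → Symmetric (Adjacent G) → Irreflexive _≡_ (Adjacent G) →
  OneDegenerate G → ∀ j → (suc n ∸ j) C j ≤ indepCount G j
indepCount-lowerBound {n} {G} G-sym G-irr G-deg j = begin
  (suc n ∸ j) C j
    ≤⟨ indepSubsetCount-lowerBound G-sym G-irr G-deg n j _ (≤-reflexive (sym (size-full n))) ⟩
  indepSubsetCount G (λ _ → true) j
    ≤⟨ countB-mono (λ I h → proj₁ (T-∧-elim h)) (allVSets n) ⟩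
  indepCount G j ∎
  where open ≤-Reasoning

-- Trees are one-degenerate

reach : ∀ {n} → Graph n → ℕ → VSet n
reach G t = iter t (reachStep G) (λ u → toℕ u ≡ᵇ 0)

module TreeProperties {n} {G : Graph n} (tree : T (isTreeB G)) where

  private
    symmetric : T (symmetricB G)
    symmetric = proj₁ (T-∧-elim {symmetricB G} tree)
    irreflexive : T (irreflexiveB G)
    irreflexive = proj₁ (T-∧-elim {irreflexiveB G} (proj₂ (T-∧-elim {symmetricB G} tree)))
    connected∧edges : T (connectedB G ∧ (numEdges G ≡ᵇ n ∸ 1))
    connected∧edges = proj₂ (T-∧-elim {irreflexiveB G} (proj₂ (T-∧-elim {symmetricB G} tree)))

  tree-symmetric : Symmetric (Adjacent G)
  tree-symmetric {i} {j} = implies (G i j) (G j i) (T-allB⁻ (T-allB⁻ symmetric (∈-allFin i)) (∈-allFin j))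
    where
      implies : ∀ a b → T (not (a ∧ not b)) → T a → T b
      implies true true _ _ = _

  tree-irreflexive : Irreflexive _≡_ (Adjacent G)
  tree-irreflexive {i} refl = T-not⇒¬T (T-allB⁻ irreflexive (∈-allFin i))

  tree-connected : ∀ v → T (reach G n v)
  tree-connected v = T-allB⁻ (proj₁ (T-∧-elim {connectedB G} connected∧edges)) (∈-allFin v)

  tree-edges : numEdges G ≡ n ∸ 1
  tree-edges = ≡ᵇ⇒≡ (numEdges G) (n ∸ 1) (proj₂ (T-∧-elim {connectedB G} connected∧edges))

-- the least t ≤ m with T (p t), and m if there is none
firstTrue : (ℕ → Bool) → ℕ → ℕ
firstTrue p zero    = zero
firstTrue p (suc m) = if p zero then zero else suc (firstTrue (p ∘ suc) m)

firstTrue-sound : ∀ (p : ℕ → Bool) m {t} → t ≤ m → T (p t) → T (p (firstTrue p m))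
firstTrue-sound p zero    {zero} _ pt = pt
firstTrue-sound p (suc m) {zero} _ pt with p zero in p0
... | true  = subst T (sym p0) _
... | false = ⊥-elim pt
firstTrue-sound p (suc m) {suc t} t<1+m pt with p zero in p0
... | true  = subst T (sym p0) _
... | false = firstTrue-sound (p ∘ suc) m (s≤s⁻¹ t<1+m) pt

firstTrue-least : ∀ (p : ℕ → Bool) m {t} → T (p t) → firstTrue p m ≤ t
firstTrue-least p zero    pt = z≤n
firstTrue-least p (suc m) {zero} pt with p zero
... | true  = z≤n
... | false = ⊥-elim pt
firstTrue-least p (suc m) {suc t} pt with p zero
... | true  = z≤n
... | false = s≤s (firstTrue-least (p ∘ suc) m pt)

depth : ∀ {n} → Graph n → Fin n → ℕ
depth {n} G v = firstTrue (λ t → reach G t v) n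

HasDescent : ∀ {n} → Graph n → (Fin n → ℕ) → Set
HasDescent G d = ∀ v → toℕ v ≢ 0 → ∃[ u ] Adjacent G u v × d u < d v

depth-descent : ∀ {n} {G : Graph n} → (∀ v → T (reach G n v)) → HasDescent G (depth G)
depth-descent {n} {G} connected v v≢0 = descend (depth G v) refl reached
  where
    reached : T (reach G (depth G v) v)
    reached = firstTrue-sound (λ t → reach G t v) n ≤-refl (connected v)
    descend : ∀ t → depth G v ≡ t → T (reach G t v) → ∃[ u ] Adjacent G u v × depth G u < depth G v
    descend zero    _   root = ⊥-elim (v≢0 (≡ᵇ⇒≡ (toℕ v) 0 root))
    descend (suc t) d≡t r with T-∨-elim r
    ... | inj₁ reach-t = ⊥-elim (1+n≰n (subst (_≤ t) d≡t (firstTrue-least (λ t → reach G t v) n reach-t)))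
    ... | inj₂ via-u with T-anyB⁻ (allFin n) via-u
    ...   | u , h with T-∧-elim h
    ...     | reach-u , Guv = u , Guv , subst (depth G u <_) (sym d≡t) (s≤s (firstTrue-least _ n reach-u))

-- Counting adjacent ordered pairs (u, v) by comparing d u with d v gives
-- 2 (n − 1) = 2 #{d u < d v} + #{d u = d v}.  Since each non-root vertex has a
-- neighbour below it, #{d u < d v} ≥ n − 1; hence no edge joins vertices of equal
-- d, and each vertex has at most one neighbour below it.
module LowerNeighbours {n} {G : Graph n} (G-sym : Symmetric (Adjacent G)) (G-irr : Irreflexive _≡_ (Adjacent G))
                       (edges : numEdges G ≡ n ∸ 1) {d : Fin n → ℕ} (descent : HasDescent G d) where

  private
    V : List (Fin n)
    V = allFin n

    below level : Fin n → Fin n → Bool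
    below u v = G u v ∧ (d u <ᵇ d v)
    level u v = G u v ∧ (d u ≡ᵇ d v)

    G-symᵇ : ∀ u v → G u v ≡ G v u
    G-symᵇ u v with G u v in Guv | G v u in Gvu
    ... | true  | true  = refl
    ... | false | false = refl
    ... | true  | false = ⊥-elim (subst T Gvu (G-sym (subst T (sym Guv) _)))
    ... | false | true  = ⊥-elim (subst T Guv (G-sym (subst T (sym Gvu) _)))

    adjacencies≡2*edges : ∑∑ V G ≡ numEdges G + numEdges G
    adjacencies≡2*edges = begin
      ∑∑ V G                                 ≡⟨ ∑∑-trichotomy G toℕ V ⟩
      ∑∑ V forward + ∑∑ V backward + ∑∑ V loops  ≡⟨ cong (λ x → x + ∑∑ V backward + ∑∑ V loops)
                                                          (∑∑-transpose G-symᵇ toℕ V) ⟨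
      ∑∑ V backward + ∑∑ V backward + ∑∑ V loops ≡⟨ cong₂ (λ x y → x + x + y) (sym edges-as-∑∑)
                                                                                   no-loops ⟩
      numEdges G + numEdges G + 0            ≡⟨ +-identityʳ _ ⟩
      numEdges G + numEdges G                ∎
      where
        open ≡-Reasoning
        forward backward loops : Fin n → Fin n → Bool
        forward  u v = G u v ∧ (toℕ u <ᵇ toℕ v)
        backward u v = G u v ∧ (toℕ v <ᵇ toℕ u)
        loops    u v = G u v ∧ (toℕ u ≡ᵇ toℕ v)
        edges-as-∑∑ : numEdges G ≡ ∑∑ V backward
        edges-as-∑∑ = ∑ˡ-cong (λ v → trans (countB≡∑𝟙 _ V) (∑ˡ-cong (λ u → cong 𝟙 (reorient v u)) V)) V
          where
            reorient : ∀ v u → ((toℕ v <ᵇ toℕ u) ∧ G v u) ≡ backward u v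
            reorient v u = trans (∧-comm (toℕ v <ᵇ toℕ u) (G v u))
                                 (cong (_∧ (toℕ v <ᵇ toℕ u)) (G-symᵇ v u))
        no-loops : ∑∑ V loops ≡ 0
        no-loops = trans (∑ˡ-cong (λ v → ∑ˡ-cong (λ u → 𝟙-¬T (no-loop u v)) V) V)
                         (trans (∑ˡ-cong (λ _ → ∑ˡ-zero V) V) (∑ˡ-zero V))
          where
            no-loop : ∀ u v → ¬ T (loops u v)
            no-loop u v h with T-∧-elim h
            ... | Guv , u≡v = G-irr (toℕ-injective (≡ᵇ⇒≡ (toℕ u) (toℕ v) u≡v)) Guv

    adjacencies≡by-depth : ∑∑ V G ≡ ∑∑ V below + ∑∑ V below + ∑∑ V level
    adjacencies≡by-depth = trans (∑∑-trichotomy G d V)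
      (cong (λ x → ∑∑ V below + x + ∑∑ V level) (∑∑-transpose G-symᵇ d V))

    nonRoot≤below : ∀ v → 𝟙 (not (toℕ v ≡ᵇ 0)) ≤ ∑[ u ∈ V ] 𝟙 (below u v)
    nonRoot≤below v with toℕ v ≡ᵇ 0 in root?
    ... | true  = z≤n
    ... | false with descent v (λ v≡0 → subst T root? (≡⇒≡ᵇ (toℕ v) 0 v≡0))
    ...   | u , Guv , du<dv = ≤-trans (≤-reflexive (sym (𝟙-T (T-∧-intro Guv (<⇒<ᵇ du<dv)))))
                                      (∈⇒≤∑ˡ (λ u → 𝟙 (below u v)) (∈-allFin u))

    n-1≤below : n ∸ 1 ≤ ∑∑ V below
    n-1≤below = begin
      n ∸ 1                              ≡⟨ nonRoots n ⟨
      countB (λ v → not (toℕ v ≡ᵇ 0)) V  ≡⟨ countB≡∑𝟙 _ V ⟩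
      ∑[ v ∈ V ] 𝟙 (not (toℕ v ≡ᵇ 0))    ≤⟨ ∑ˡ-mono-≤ nonRoot≤below V ⟩
      ∑∑ V below                         ∎
      where open ≤-Reasoning

    below+below+level≡ : ∑∑ V below + ∑∑ V below + ∑∑ V level ≡ (n ∸ 1) + (n ∸ 1)
    below+below+level≡ = trans (sym adjacencies≡by-depth) (trans adjacencies≡2*edges (cong₂ _+_ edges edges))

    no-level : ∑∑ V level ≡ 0
    no-level = n≤0⇒n≡0 (+-cancelˡ-≤ ((n ∸ 1) + (n ∸ 1)) _ 0 (begin
      (n ∸ 1) + (n ∸ 1) + ∑∑ V level        ≤⟨ +-monoˡ-≤ _ (+-mono-≤ n-1≤below n-1≤below) ⟩
      ∑∑ V below + ∑∑ V below + ∑∑ V level  ≡⟨ below+below+level≡ ⟩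
      (n ∸ 1) + (n ∸ 1)                     ≡⟨ +-identityʳ _ ⟨
      (n ∸ 1) + (n ∸ 1) + 0                 ∎))
      where open ≤-Reasoning

    below≤n-1 : ∑∑ V below ≤ n ∸ 1
    below≤n-1 = +-cancelʳ-≤ (n ∸ 1) _ _ (begin
      ∑∑ V below + (n ∸ 1)                  ≤⟨ +-monoʳ-≤ _ n-1≤below ⟩
      ∑∑ V below + ∑∑ V below               ≤⟨ m≤m+n _ _ ⟩
      ∑∑ V below + ∑∑ V below + ∑∑ V level  ≡⟨ below+below+level≡ ⟩
      (n ∸ 1) + (n ∸ 1)                     ∎)
      where open ≤-Reasoning

    below≤nonRoots : ∑∑ V below ≤ ∑[ v ∈ V ] 𝟙 (not (toℕ v ≡ᵇ 0))
    below≤nonRoots = ≤-trans below≤n-1 (≤-reflexive (trans (sym (nonRoots n)) (countB≡∑𝟙 _ V)))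

    at-most-one-below : ∀ v → countB (λ u → below u v) V ≤ 1
    at-most-one-below v = begin
      countB (λ u → below u v) V  ≡⟨ countB≡∑𝟙 _ V ⟩
      ∑[ u ∈ V ] 𝟙 (below u v)    ≤⟨ ∑ˡ-squeeze nonRoot≤below below≤nonRoots (∈-allFin v) ⟩
      𝟙 (not (toℕ v ≡ᵇ 0))        ≤⟨ 𝟙≤1 _ ⟩
      1                           ∎
      where open ≤-Reasoning

    ¬level : ∀ u v → ¬ T (level u v)
    ¬level u v h = <⇒≱ (begin
      1                           ≡⟨ 𝟙-T h ⟨
      𝟙 (level u v)               ≤⟨ ∈⇒≤∑ˡ (λ u → 𝟙 (level u v)) (∈-allFin u) ⟩
      ∑[ u′ ∈ V ] 𝟙 (level u′ v)  ≤⟨ ∈⇒≤∑ˡ (λ v′ → ∑[ u′ ∈ V ] 𝟙 (level u′ v′)) (∈-allFin v) ⟩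
      ∑∑ V level                  ∎) (≤-reflexive no-level)
      where open ≤-Reasoning

  lowerNeighbour-unique : ∀ {v u w} → Adjacent G u v → Adjacent G w v → d u ≤ d v → d w ≤ d v → u ≡ w
  lowerNeighbour-unique {v} {u} {w} Guv Gwv du≤dv dw≤dv =
    countB≤1⇒unique (λ x → below x v) (at-most-one-below v) (∈-allFin u) (∈-allFin w)
                    (strictly Guv du≤dv) (strictly Gwv dw≤dv)
    where
      strictly : ∀ {x} → Adjacent G x v → d x ≤ d v → T (below x v)
      strictly {x} Gxv dx≤dv with m≤n⇒m<n∨m≡n dx≤dv
      ... | inj₁ dx<dv = T-∧-intro Gxv (<⇒<ᵇ dx<dv)
      ... | inj₂ dx≡dv = ⊥-elim (¬level x v (T-∧-intro Gxv (≡⇒≡ᵇ (d x) (d v) dx≡dv)))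

lowerNeighbours-unique⇒oneDegenerate : ∀ {n} {G : Graph n} (d : Fin n → ℕ) →
  (∀ {v u w} → Adjacent G u v → Adjacent G w v → d u ≤ d v → d w ≤ d v → u ≡ w) → OneDegenerate G
lowerNeighbours-unique⇒oneDegenerate {n} d unique S {v₀} Sv₀ =
  v , Sv , λ Su Sw Guv Gwv → unique Guv Gwv (maximal Su) (maximal Sw)
  where
    members : List (Fin n)
    members = filter (λ u → T? (S u)) (allFin n)
    v : Fin n
    v = argmax d v₀ members
    Sv : T (S v)
    Sv = argmax-all d Sv₀ (all-filter (λ u → T? (S u)) (allFin n))
    maximal : ∀ {u} → T (S u) → d u ≤ d v
    maximal {u} Su = All.lookup (f[xs]≤f[argmax] v₀ members) (∈-filter⁺ (λ u → T? (S u)) (∈-allFin u) Su)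

tree⇒oneDegenerate : ∀ {n} {G : Graph n} → T (isTreeB G) → OneDegenerate G
tree⇒oneDegenerate {G = G} tree = lowerNeighbours-unique⇒oneDegenerate (depth G)
  (LowerNeighbours.lowerNeighbour-unique tree-symmetric tree-irreflexive tree-edges (depth-descent tree-connected))
  where open TreeProperties {G = G} tree

tree-indepCount-lowerBound : ∀ {n} {G : Graph n} → T (isTreeB G) → ∀ j → (suc n ∸ j) C j ≤ indepCount G j
tree-indepCount-lowerBound {G = G} tree =
  indepCount-lowerBound tree-symmetric tree-irreflexive (tree⇒oneDegenerate tree)
  where open TreeProperties {G = G} tree

-- Partial sums of the exponential series

∑ℕ : ℕ → (ℕ → ℕ) → ℕ
∑ℕ n f = ∑[ i < n ] f (toℕ i)

∑ℕ-cong< : ∀ n {f g : ℕ → ℕ} → (∀ i → i < n → f i ≡ g i) → ∑ℕ n f ≡ ∑ℕ n g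
∑ℕ-cong< n f≗g = sum-cong-≗ {n} (λ i → f≗g (toℕ i) (toℕ<n i))

∑ℕ-≤-suc : ∀ n f → ∑ℕ n f ≤ ∑ℕ (suc n) f
∑ℕ-≤-suc zero    f = z≤n
∑ℕ-≤-suc (suc n) f = +-monoʳ-≤ (f 0) (∑ℕ-≤-suc n (f ∘ suc))

binomial : ∀ x y t → (x + y) ^ t ≡ ∑ℕ (suc t) (λ k → (t C k) * (x ^ k * y ^ (t ∸ k)))
binomial x y t = trans (sym (^≡^ (x + y) t)) (trans (Binomial.theorem t x y) (sum-cong-≗ {suc t} term≡))
  where
    ^≡^ : ∀ x n → x Exp.^ n ≡ x ^ n
    ^≡^ x zero    = refl
    ^≡^ x (suc n) = cong (x *_) (^≡^ x n)
    ×≡* : ∀ m x → m RawMonoid.× x ≡ m * x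
    ×≡* zero    x = refl
    ×≡* (suc m) x = cong (x +_) (×≡* m x)
    term≡ : ∀ k → Binomial.binomialTerm x y t k ≡ (t C toℕ k) * (x ^ toℕ k * y ^ (t ∸ toℕ k))
    term≡ k = trans (×≡* (t C toℕ k) _)
                    (cong₂ (λ a b → (t C toℕ k) * (a * b)) (^≡^ x (toℕ k)) (^≡^ y (t ∸ toℕ k)))

∑ℕ-convolution-≤ : ∀ M (f g : ℕ → ℕ) →
  ∑ℕ M (λ t → ∑ℕ (suc t) (λ k → f k * g (t ∸ k))) ≤ ∑ℕ M f * ∑ℕ M g
∑ℕ-convolution-≤ zero    f g = z≤n
∑ℕ-convolution-≤ (suc M) f g = begin
  f 0 * g 0 + 0 + ∑ℕ M (λ t → f 0 * g (suc t) + ∑ℕ (suc t) (λ k → f (suc k) * g (t ∸ k)))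
    ≡⟨ cong (f 0 * g 0 + 0 +_) (∑-distrib-+ {M} (λ t → f 0 * g (suc (toℕ t))) _) ⟩
  f 0 * g 0 + 0 + (∑ℕ M (λ t → f 0 * g (suc t)) + ∑ℕ M (λ t → ∑ℕ (suc t) (λ k → f (suc k) * g (t ∸ k))))
    ≤⟨ +-monoʳ-≤ (f 0 * g 0 + 0) (+-mono-≤ (≤-reflexive (sym (*-distribˡ-sum {M} (f 0) _)))
                                            (∑ℕ-convolution-≤ M (f ∘ suc) g)) ⟩
  f 0 * g 0 + 0 + (f 0 * Gs + Fs * ∑ℕ M g)
    ≤⟨ +-monoʳ-≤ (f 0 * g 0 + 0) (+-monoʳ-≤ (f 0 * Gs) (*-monoʳ-≤ Fs (∑ℕ-≤-suc M g))) ⟩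
  f 0 * g 0 + 0 + (f 0 * Gs + Fs * (g 0 + Gs))
    ≡⟨ solve 4 (λ f₀ g₀ Fs Gs → f₀ :* g₀ :+ con 0 :+ (f₀ :* Gs :+ Fs :* (g₀ :+ Gs))
                              := (f₀ :+ Fs) :* (g₀ :+ Gs)) refl (f 0) (g 0) Fs Gs ⟩
  (f 0 + Fs) * (g 0 + Gs) ∎
  where
    open ≤-Reasoning
    Fs Gs : ℕ
    Fs = ∑ℕ M (f ∘ suc)
    Gs = ∑ℕ M (g ∘ suc)

infix 8 _↓_

-- m ↓ j = m! / j! when j ≤ m
_↓_ : ℕ → ℕ → ℕ
zero  ↓ j = 1
suc m ↓ j = if j ≤ᵇ m then suc m * (m ↓ j) else 1

↓-suc : ∀ {m j} → j ≤ m → suc m ↓ j ≡ suc m * (m ↓ j)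
↓-suc j≤m rewrite Equivalence.to T-≡ (≤⇒≤ᵇ j≤m) = refl

↓-self : ∀ m → m ↓ m ≡ 1
↓-self zero    = refl
↓-self (suc m) with suc m ≤ᵇ m in 1+m≤m
... | true  = ⊥-elim (1+n≰n (≤ᵇ⇒≤ (suc m) m (subst T (sym 1+m≤m) _)))
... | false = refl

↓*! : ∀ {m j} → j ≤ m → (m ↓ j) * j ! ≡ m !
↓*! {zero}  z≤n   = refl
↓*! {suc m} {j} j≤1+m with m≤n⇒m<n∨m≡n j≤1+m
... | inj₂ refl  = trans (cong (_* j !) (↓-self j)) (+-identityʳ _)
... | inj₁ j<1+m = begin
  (suc m ↓ j) * j !        ≡⟨ cong (_* j !) (↓-suc (s≤s⁻¹ j<1+m)) ⟩
  suc m * (m ↓ j) * j !    ≡⟨ *-assoc (suc m) (m ↓ j) (j !) ⟩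
  suc m * ((m ↓ j) * j !)  ≡⟨ cong (suc m *_) (↓*! (s≤s⁻¹ j<1+m)) ⟩
  suc m * m !              ∎
  where open ≡-Reasoning

C*!*!≡! : ∀ {t k} → k ≤ t → (t C k) * (k ! * (t ∸ k) !) ≡ t !
C*!*!≡! {t} {k} k≤t = trans (cong (_* (k ! * (t ∸ k) !)) (nCk≡n!/k![n-k]! k≤t))
                            (m/n*n≡m {{k !* (t ∸ k) !≢0}} (k![n∸k]!∣n! k≤t))

↓-binomial : ∀ {m t k} → k ≤ t → t ≤ m → m ! * (m ↓ t) * (t C k) ≡ (m ↓ k) * (m ↓ (t ∸ k))
↓-binomial {m} {t} {k} k≤t t≤m = *-cancelʳ-≡ _ _ (k ! * (t ∸ k) !) {{k !* (t ∸ k) !≢0}} (begin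
  m ! * (m ↓ t) * (t C k) * (k ! * (t ∸ k) !)    ≡⟨ *-assoc (m ! * (m ↓ t)) _ _ ⟩
  m ! * (m ↓ t) * ((t C k) * (k ! * (t ∸ k) !))  ≡⟨ cong (m ! * (m ↓ t) *_) (C*!*!≡! k≤t) ⟩
  m ! * (m ↓ t) * t !                            ≡⟨ *-assoc (m !) _ _ ⟩
  m ! * ((m ↓ t) * t !)                          ≡⟨ cong (m ! *_) (↓*! t≤m) ⟩
  m ! * m !
    ≡⟨ cong₂ _*_ (↓*! (≤-trans k≤t t≤m)) (↓*! (≤-trans (m∸n≤m t k) t≤m)) ⟨
  (m ↓ k) * k ! * ((m ↓ (t ∸ k)) * (t ∸ k) !)
    ≡⟨ [m*n]*[o*p]≡[m*o]*[n*p] (m ↓ k) (k !) (m ↓ (t ∸ k)) ((t ∸ k) !) ⟩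
  (m ↓ k) * (m ↓ (t ∸ k)) * (k ! * (t ∸ k) !) ∎)
  where open ≡-Reasoning

-- m! · Σ_{j ≤ m} b^j / j!, so that expPartial b m = expNumerator b m / m!
expNumerator : ℕ → ℕ → ℕ
expNumerator b m = ∑ℕ (suc m) (λ j → b ^ j * (m ↓ j))

expNumerator-suc : ∀ b m → expNumerator b (suc m) ≡ suc m * expNumerator b m + b ^ suc m
expNumerator-suc b m = begin
  expNumerator b (suc m)
    ≡⟨ sum-init-last {suc m} (λ i → b ^ toℕ i * (suc m ↓ toℕ i)) ⟩
  ∑[ i < suc m ] (b ^ toℕ (inject₁ i) * (suc m ↓ toℕ (inject₁ i))) +
  b ^ toℕ (fromℕ (suc m)) * (suc m ↓ toℕ (fromℕ (suc m)))
    ≡⟨ cong₂ _+_ (sum-cong-≗ {suc m} initial) final ⟩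
  ∑[ i < suc m ] (suc m * (b ^ toℕ i * (m ↓ toℕ i))) + b ^ suc m
    ≡⟨ cong (_+ b ^ suc m) (*-distribˡ-sum {suc m} (suc m) (λ i → b ^ toℕ i * (m ↓ toℕ i))) ⟨
  suc m * expNumerator b m + b ^ suc m ∎
  where
    open ≡-Reasoning
    initial : ∀ i → b ^ toℕ (inject₁ i) * (suc m ↓ toℕ (inject₁ i)) ≡ suc m * (b ^ toℕ i * (m ↓ toℕ i))
    initial i = begin
      b ^ toℕ (inject₁ i) * (suc m ↓ toℕ (inject₁ i))
        ≡⟨ cong (λ j → b ^ j * (suc m ↓ j)) (toℕ-inject₁ i) ⟩
      b ^ toℕ i * (suc m ↓ toℕ i)
        ≡⟨ cong (b ^ toℕ i *_) (↓-suc (s≤s⁻¹ (toℕ<n i))) ⟩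
      b ^ toℕ i * (suc m * (m ↓ toℕ i))
        ≡⟨ x*[y*z]≡y*[x*z] (b ^ toℕ i) (suc m) (m ↓ toℕ i) ⟩
      suc m * (b ^ toℕ i * (m ↓ toℕ i)) ∎
    final : b ^ toℕ (fromℕ (suc m)) * (suc m ↓ toℕ (fromℕ (suc m))) ≡ b ^ suc m
    final = trans (cong (λ j → b ^ j * (suc m ↓ j)) (toℕ-fromℕ (suc m)))
                  (trans (cong (b ^ suc m *_) (↓-self (suc m))) (*-identityʳ _))

expNumerator-zero : ∀ m → expNumerator 0 m ≡ m !
expNumerator-zero m = begin
  expNumerator 0 m  ≡⟨ cong ((m ↓ 0 + 0) +_) (sum-replicate-zero m) ⟩
  m ↓ 0 + 0 + 0     ≡⟨ trans (+-identityʳ _) (+-identityʳ _) ⟩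
  m ↓ 0             ≡⟨ *-identityʳ _ ⟨
  m ↓ 0 * 0 !       ≡⟨ ↓*! {m} z≤n ⟩
  m !               ∎
  where open ≡-Reasoning

expNumerator-submultiplicative : ∀ a b m → m ! * expNumerator (a + b) m ≤ expNumerator a m * expNumerator b m
expNumerator-submultiplicative a b m = begin
  m ! * expNumerator (a + b) m
    ≡⟨ *-distribˡ-sum {suc m} (m !) (λ t → (a + b) ^ toℕ t * (m ↓ toℕ t)) ⟩
  ∑ℕ (suc m) (λ t → m ! * ((a + b) ^ t * (m ↓ t)))
    ≡⟨ ∑ℕ-cong< (suc m) (λ t t<1+m → expand (s≤s⁻¹ t<1+m)) ⟩
  ∑ℕ (suc m) (λ t → ∑ℕ (suc t) (λ k → (a ^ k * (m ↓ k)) * (b ^ (t ∸ k) * (m ↓ (t ∸ k)))))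
    ≤⟨ ∑ℕ-convolution-≤ (suc m) (λ i → a ^ i * (m ↓ i)) (λ j → b ^ j * (m ↓ j)) ⟩
  expNumerator a m * expNumerator b m ∎
  where
    open ≤-Reasoning
    term : ∀ {t k} → k ≤ t → t ≤ m →
           (t C k) * (a ^ k * b ^ (t ∸ k)) * (m ! * (m ↓ t)) ≡ (a ^ k * (m ↓ k)) * (b ^ (t ∸ k) * (m ↓ (t ∸ k)))
    term {t} {k} k≤t t≤m = begin-equality
      (t C k) * (a ^ k * b ^ (t ∸ k)) * (m ! * (m ↓ t))
        ≡⟨ solve 5 (λ c x y f d → c :* (x :* y) :* (f :* d) := x :* y :* (f :* d :* c))
                   refl (t C k) (a ^ k) (b ^ (t ∸ k)) (m !) (m ↓ t) ⟩
      a ^ k * b ^ (t ∸ k) * (m ! * (m ↓ t) * (t C k))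
        ≡⟨ cong (a ^ k * b ^ (t ∸ k) *_) (↓-binomial k≤t t≤m) ⟩
      a ^ k * b ^ (t ∸ k) * ((m ↓ k) * (m ↓ (t ∸ k)))
        ≡⟨ [m*n]*[o*p]≡[m*o]*[n*p] (a ^ k) (b ^ (t ∸ k)) (m ↓ k) (m ↓ (t ∸ k)) ⟩
      (a ^ k * (m ↓ k)) * (b ^ (t ∸ k) * (m ↓ (t ∸ k))) ∎
    expand : ∀ {t} → t ≤ m → m ! * ((a + b) ^ t * (m ↓ t)) ≡
                             ∑ℕ (suc t) (λ k → (a ^ k * (m ↓ k)) * (b ^ (t ∸ k) * (m ↓ (t ∸ k))))
    expand {t} t≤m = begin-equality
      m ! * ((a + b) ^ t * (m ↓ t))
        ≡⟨ x*[y*z]≡y*[x*z] (m !) ((a + b) ^ t) (m ↓ t) ⟩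
      (a + b) ^ t * (m ! * (m ↓ t))
        ≡⟨ cong (_* (m ! * (m ↓ t))) (binomial a b t) ⟩
      ∑ℕ (suc t) (λ k → (t C k) * (a ^ k * b ^ (t ∸ k))) * (m ! * (m ↓ t))
        ≡⟨ *-distribʳ-sum {suc t} (m ! * (m ↓ t)) (λ k → (t C toℕ k) * (a ^ toℕ k * b ^ (t ∸ toℕ k))) ⟩
      ∑ℕ (suc t) (λ k → (t C k) * (a ^ k * b ^ (t ∸ k)) * (m ! * (m ↓ t)))
        ≡⟨ ∑ℕ-cong< (suc t) (λ k k<1+t → term (s≤s⁻¹ k<1+t) t≤m) ⟩
      ∑ℕ (suc t) (λ k → (a ^ k * (m ↓ k)) * (b ^ (t ∸ k) * (m ↓ (t ∸ k)))) ∎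

expNumerator-*-≤ : ∀ c b m → (m !) ^ c * expNumerator (c * b) m ≤ m ! * expNumerator b m ^ c
expNumerator-*-≤ zero    b m = ≤-reflexive (trans (+-identityʳ _) (trans (expNumerator-zero m) (sym (*-identityʳ _))))
expNumerator-*-≤ (suc c) b m = begin
  m ! * (m !) ^ c * expNumerator (b + c * b) m    ≡⟨ [x*y]*z≡y*[x*z] (m !) ((m !) ^ c) _ ⟩
  (m !) ^ c * (m ! * expNumerator (b + c * b) m)  ≤⟨ *-monoʳ-≤ ((m !) ^ c)
                                                       (expNumerator-submultiplicative b (c * b) m) ⟩
  (m !) ^ c * (E * expNumerator (c * b) m)        ≡⟨ x*[y*z]≡y*[x*z] ((m !) ^ c) E _ ⟩
  E * ((m !) ^ c * expNumerator (c * b) m)        ≤⟨ *-monoʳ-≤ E (expNumerator-*-≤ c b m) ⟩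
  E * (m ! * E ^ c)                               ≡⟨ x*[y*z]≡y*[x*z] E (m !) (E ^ c) ⟩
  m ! * E ^ suc c                                 ∎
  where
    open ≤-Reasoning
    E : ℕ
    E = expNumerator b m

module _ where
  open ℚᵘ using (_≃_; *≡*; *≤*)

  /-≃-/ : ∀ a x c y .{{_ : NonZero x}} .{{_ : NonZero y}} → a * y ≡ c * x → ℤ.+ a ℚᵘ./ x ≃ ℤ.+ c ℚᵘ./ y
  /-≃-/ a (suc x) c (suc y) eq = *≡* (trans (sym (ℤP.pos-* a (suc y))) (trans (cong ℤ.+_ eq) (ℤP.pos-* c (suc x))))

  /-≤-/ : ∀ a x c y .{{_ : NonZero x}} .{{_ : NonZero y}} →
          (ℤ.+ a ℚᵘ./ x ℚᵘ.≤ ℤ.+ c ℚᵘ./ y) ⇔ (a * y ≤ c * x)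
  /-≤-/ a (suc x) c (suc y) = mk⇔
    (λ { (*≤* le) → ℤP.drop‿+≤+ (subst₂ ℤ._≤_ (sym (ℤP.pos-* a (suc y))) (sym (ℤP.pos-* c (suc x))) le) })
    (λ le → *≤* (subst₂ ℤ._≤_ (ℤP.pos-* a (suc y)) (ℤP.pos-* c (suc x)) (ℤ.+≤+ le)))

  /-+-/ : ∀ a x c y .{{_ : NonZero x}} .{{_ : NonZero y}} →
          (ℤ.+ a ℚᵘ./ x) ℚᵘ.+ (ℤ.+ c ℚᵘ./ y) ≃ (ℤ.+ (a * y + c * x) ℚᵘ./ (x * y)) {{m*n≢0 x y}}
  /-+-/ a (suc x) c (suc y) = ℚᵘP.≃-reflexive
    (cong (λ z → z ℚᵘ./ (suc x * suc y)) (cong₂ ℤ._+_ (sym (ℤP.pos-* a (suc y))) (sym (ℤP.pos-* c (suc x)))))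

  toℚᵘ-/ : ∀ a d .{{_ : NonZero d}} → ℚ.toℚᵘ (ℤ.+ a ℚ./ d) ≃ ℤ.+ a ℚᵘ./ d
  toℚᵘ-/ a (suc d) = ℚP.toℚᵘ-fromℚᵘ (ℤ.+ a ℚᵘ./ suc d)

  toℚᵘ-expPartial : ∀ b m → ℚ.toℚᵘ (expPartial b m) ≃ (ℤ.+ expNumerator b m ℚᵘ./ m !) {{m !≢0}}
  toℚᵘ-expPartial b zero    = ℚᵘP.≃-refl
  toℚᵘ-expPartial b (suc m) = begin-equality
    ℚ.toℚᵘ (expPartial b m ℚ.+ (ℤ.+ (b ^ suc m) ℚ./ suc m !) {{suc m !≢0}})
      ≃⟨ ℚP.toℚᵘ-homo-+ (expPartial b m) _ ⟩
    ℚ.toℚᵘ (expPartial b m) ℚᵘ.+ ℚ.toℚᵘ ((ℤ.+ (b ^ suc m) ℚ./ suc m !) {{suc m !≢0}})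
      ≃⟨ ℚᵘP.+-cong (toℚᵘ-expPartial b m) (toℚᵘ-/ (b ^ suc m) (suc m !) {{suc m !≢0}}) ⟩
    (ℤ.+ E ℚᵘ./ m !) {{m !≢0}} ℚᵘ.+ (ℤ.+ (b ^ suc m) ℚᵘ./ suc m !) {{suc m !≢0}}
      ≃⟨ /-+-/ E (m !) (b ^ suc m) (suc m !) {{m !≢0}} {{suc m !≢0}} ⟩
    (ℤ.+ (E * suc m ! + b ^ suc m * m !) ℚᵘ./ (m ! * suc m !)) {{m!*[1+m]!≢0}}
      ≃⟨ /-≃-/ _ _ _ _ {{m!*[1+m]!≢0}} {{suc m !≢0}} cross-multiplied ⟩
    (ℤ.+ expNumerator b (suc m) ℚᵘ./ suc m !) {{suc m !≢0}} ∎
    where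
      open ℚᵘP.≤-Reasoning
      E : ℕ
      E = expNumerator b m
      m!*[1+m]!≢0 : NonZero (m ! * suc m !)
      m!*[1+m]!≢0 = m !* suc m !≢0
      cross-multiplied : (E * suc m ! + b ^ suc m * m !) * suc m ! ≡ expNumerator b (suc m) * (m ! * suc m !)
      cross-multiplied rewrite expNumerator-suc b m =
        solve 4 (λ E x s f → (E :* (s :* f) :+ x :* f) :* (s :* f) := (s :* E :+ x) :* (f :* (s :* f)))
              refl E (b ^ suc m) (suc m) (m !)

  fromℕ≤expPartial⇔ : ∀ x b m → (ℤ.+ x ℚ./ 1 ℚ.≤ expPartial b m) ⇔ (x * m ! ≤ expNumerator b m)
  fromℕ≤expPartial⇔ x b m = mk⇔
    (λ x≤e → ≤-trans (Equivalence.to (/-≤-/ x 1 E (m !) {{_}} {{m !≢0}})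
                        (ℚᵘP.≤-respʳ-≃ (toℚᵘ-expPartial b m)
                          (ℚᵘP.≤-respˡ-≃ (toℚᵘ-/ x 1) (ℚP.toℚᵘ-mono-≤ x≤e))))
                     (≤-reflexive (*-identityʳ E)))
    (λ x*m!≤E → ℚP.toℚᵘ-cancel-≤ (ℚᵘP.≤-respˡ-≃ (ℚᵘP.≃-sym (toℚᵘ-/ x 1))
                  (ℚᵘP.≤-respʳ-≃ (ℚᵘP.≃-sym (toℚᵘ-expPartial b m))
                    (Equivalence.from (/-≤-/ x 1 E (m !) {{_}} {{m !≢0}})
                      (≤-trans x*m!≤E (≤-reflexive (sym (*-identityʳ E))))))))
    where
      E : ℕ
      E = expNumerator b m

infix 4 _≤exp_

-- x ≤ e^b, witnessed by a partial sum of the exponential series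
_≤exp_ : ℕ → ℕ → Set
x ≤exp b = ∃[ m ] x * m ! ≤ expNumerator b m

mulLogLe⇔ : ∀ a n b → MulLogLe a n b ⇔ n ^ a ≤exp b
mulLogLe⇔ a n b = mk⇔ (λ (m , h) → m , Equivalence.to (fromℕ≤expPartial⇔ (n ^ a) b m) h)
                      (λ (m , h) → m , Equivalence.from (fromℕ≤expPartial⇔ (n ^ a) b m) h)

≤exp-mono : ∀ {x y b} → x ≤ y → y ≤exp b → x ≤exp b
≤exp-mono x≤y (m , y*m!≤E) = m , ≤-trans (*-monoˡ-≤ _ x≤y) y*m!≤E

≤exp0⇒≤1 : ∀ {x} → x ≤exp 0 → x ≤ 1
≤exp0⇒≤1 {x} (m , x*m!≤E) = *-cancelʳ-≤ x 1 (m !) {{m !≢0}}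
  (≤-trans x*m!≤E (≤-reflexive (trans (expNumerator-zero m) (sym (*-identityˡ (m !))))))

^-distribʳ-* : ∀ x y c → (x * y) ^ c ≡ x ^ c * y ^ c
^-distribʳ-* x y zero    = refl
^-distribʳ-* x y (suc c) =
  trans (cong (x * y *_) (^-distribʳ-* x y c)) ([m*n]*[o*p]≡[m*o]*[n*p] x y (x ^ c) (y ^ c))

^-cancelʳ-≤ : ∀ {x y} c → 1 ≤ c → x ^ c ≤ y ^ c → x ≤ y
^-cancelʳ-≤ {x} {y} (suc c) _ x^c≤y^c with x ≤? y
... | yes x≤y = x≤y
... | no  x≰y = ⊥-elim (<⇒≱ (^-monoˡ-< (suc c) (≰⇒> x≰y)) x^c≤y^c)

^-≤exp-*⇒≤exp : ∀ {x b} c → 1 ≤ c → x ^ c ≤exp c * b → x ≤exp b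
^-≤exp-*⇒≤exp {x} {b} c 1≤c (m , x^c*m!≤E) = m , ^-cancelʳ-≤ c 1≤c (*-cancelʳ-≤ _ _ (m !) {{m !≢0}} (begin
  (x * m !) ^ c * m !                 ≡⟨ cong (_* m !) (^-distribʳ-* x (m !) c) ⟩
  x ^ c * (m !) ^ c * m !             ≡⟨ [x*y]*z≡y*[x*z] (x ^ c) ((m !) ^ c) (m !) ⟩
  (m !) ^ c * (x ^ c * m !)           ≤⟨ *-monoʳ-≤ ((m !) ^ c) x^c*m!≤E ⟩
  (m !) ^ c * expNumerator (c * b) m  ≤⟨ expNumerator-*-≤ c b m ⟩
  m ! * expNumerator b m ^ c          ≡⟨ *-comm (m !) _ ⟩
  expNumerator b m ^ c * m !          ∎))
  where open ≤-Reasoning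

-- (bad · n) · c · ln n ≤ (S · n²) · ln n ≤ c · N; when c = 0 the hypothesis forces S = 0.
mulLogLe-cancel : ∀ {n bad S c N} → 2 ≤ n → bad * c ≤ S * n → bad ≤ S →
  MulLogLe (S * n ^ 2) n (c * N) → MulLogLe (bad * n) n N
mulLogLe-cancel {n} {bad} {S} {zero} {N} 2≤n _ bad≤S hyp =
  Equivalence.from (mulLogLe⇔ (bad * n) n N) (subst (λ b → n ^ (b * n) ≤exp N) (sym bad≡0) (0 , ≤-refl))
  where
    n≢0 : NonZero n
    n≢0 = >-nonZero (≤-trans (s≤s z≤n) 2≤n)
    n^m≤1⇒m≡0 : ∀ m → n ^ m ≤ 1 → m ≡ 0
    n^m≤1⇒m≡0 zero    _     = refl
    n^m≤1⇒m≡0 (suc m) n^m≤1 = ⊥-elim (<⇒≱ (≤-trans 2≤n (m≤m*n n (n ^ m) {{m^n≢0 n m {{n≢0}}}})) n^m≤1)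
    S*n^2≡0 : S * n ^ 2 ≡ 0
    S*n^2≡0 = n^m≤1⇒m≡0 (S * n ^ 2) (≤exp0⇒≤1 (Equivalence.to (mulLogLe⇔ (S * n ^ 2) n 0) hyp))
    bad≡0 : bad ≡ 0
    bad≡0 = n≤0⇒n≡0 (≤-trans bad≤S (≤-trans (m≤m*n S (n ^ 2) {{m^n≢0 n 2 {{n≢0}}}})
                                            (≤-reflexive S*n^2≡0)))
mulLogLe-cancel {n} {bad} {S} {suc c} {N} 2≤n bad*c≤S*n _ hyp =
  Equivalence.from (mulLogLe⇔ (bad * n) n N)
    (^-≤exp-*⇒≤exp {n ^ (bad * n)} {N} (suc c) (s≤s z≤n)
      (≤exp-mono {b = suc c * N} n^[bad*n]^c≤n^[S*n^2] (Equivalence.to (mulLogLe⇔ (S * n ^ 2) n (suc c * N)) hyp)))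
  where
    open ≤-Reasoning
    exponent≤ : bad * n * suc c ≤ S * n ^ 2
    exponent≤ = begin
      bad * n * suc c  ≡⟨ solve 3 (λ b n c → b :* n :* c := b :* c :* n) refl bad n (suc c) ⟩
      bad * suc c * n  ≤⟨ *-monoˡ-≤ n bad*c≤S*n ⟩
      S * n * n        ≡⟨ solve 2 (λ s n → s :* n :* n := s :* (n :* (n :* con 1))) refl S n ⟩
      S * n ^ 2        ∎
    n^[bad*n]^c≤n^[S*n^2] : (n ^ (bad * n)) ^ suc c ≤ n ^ (S * n ^ 2)
    n^[bad*n]^c≤n^[S*n^2] = begin
      (n ^ (bad * n)) ^ suc c  ≡⟨ ^-*-assoc n (bad * n) (suc c) ⟩
      n ^ (bad * n * suc c)    ≤⟨ ^-monoʳ-≤ n {{>-nonZero (≤-trans (s≤s z≤n) 2≤n)}} exponent≤ ⟩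
      n ^ (S * n ^ 2)          ∎

1≤m*n⇒1≤m : ∀ {m} n → 1 ≤ m * n → 1 ≤ m
1≤m*n⇒1≤m {suc m} n _ = s≤s z≤n

lowExtCount-bound : ∀ {n} {G : Graph n} k → T (isTreeB G) → k + 2 ≤ n →
  T (not (indepCount G k ≤ᵇ indepCount G (suc k))) → (n + 1 ∸ k) C k ≤ lowExtCount G k * n × 1 ≤ lowExtCount G k
lowExtCount-bound {n} {G} k tree k+2≤n i[k]≰i[1+k] =
  C≤x*n , 1≤m*n⇒1≤m (2 + k) (≤-trans (≤-trans (s≤s z≤n) b<a) a≤x*[2+k])
  where
    open ≤-Reasoning
    a b x : ℕ
    a = indepCount G k
    b = indepCount G (suc k)
    x = lowExtCount G k
    b<a : b < a
    b<a = ¬T-≤ᵇ⇒> (T-not⇒¬T i[k]≰i[1+k])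
    a≤x*[2+k] : a ≤ x * (2 + k)
    a≤x*[2+k] = +-cancelʳ-≤ (b * suc k) a (x * (2 + k)) (begin
      a + b * suc k            ≤⟨ +-monoʳ-≤ a (*-monoˡ-≤ (suc k) (<⇒≤ b<a)) ⟩
      a + a * suc k            ≡⟨ *-suc a (suc k) ⟨
      a * (2 + k)              ≤⟨ indepCount-≤-lowExtCount G k ⟩
      b * suc k + x * (2 + k)  ≡⟨ +-comm (b * suc k) _ ⟩
      x * (2 + k) + b * suc k  ∎)
    C≤x*n : (n + 1 ∸ k) C k ≤ x * n
    C≤x*n = begin
      (n + 1 ∸ k) C k  ≡⟨ cong (λ m → (m ∸ k) C k) (+-comm n 1) ⟩
      (suc n ∸ k) C k  ≤⟨ tree-indepCount-lowerBound tree k ⟩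
      a                ≤⟨ a≤x*[2+k] ⟩
      x * (2 + k)      ≤⟨ *-monoʳ-≤ x (≤-trans (≤-reflexive (+-comm 2 k)) k+2≤n) ⟩
      x * n            ∎

highExtCount-bound : ∀ {n} {G : Graph n} k → T (isTreeB G) →
  T (not (indepCount G (suc k) ≤ᵇ indepCount G k)) → (n ∸ k) C (k + 1) ≤ highExtCount G k * n × 1 ≤ highExtCount G k
highExtCount-bound {n} {G} k tree i[1+k]≰i[k] =
  C≤y*n , 1≤m*n⇒1≤m (n ∸ k) (≤-trans (≤-trans (s≤s z≤n) a<b) b≤y*[n∸k])
  where
    open ≤-Reasoning
    a b y : ℕ
    a = indepCount G k
    b = indepCount G (suc k)
    y = highExtCount G k
    a<b : a < b
    a<b = ¬T-≤ᵇ⇒> (T-not⇒¬T i[1+k]≰i[k])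
    b≤y*[n∸k] : b ≤ y * (n ∸ k)
    b≤y*[n∸k] = +-cancelʳ-≤ (b * k) b (y * (n ∸ k)) (begin
      b + b * k            ≡⟨ *-suc b k ⟨
      b * suc k            ≤⟨ indepCount-≤-highExtCount G k ⟩
      a * k + y * (n ∸ k)  ≤⟨ +-monoˡ-≤ _ (*-monoˡ-≤ k (<⇒≤ a<b)) ⟩
      b * k + y * (n ∸ k)  ≡⟨ +-comm (b * k) _ ⟩
      y * (n ∸ k) + b * k  ∎)
    C≤y*n : (n ∸ k) C (k + 1) ≤ y * n
    C≤y*n = begin
      (n ∸ k) C (k + 1)  ≡⟨ cong ((n ∸ k) C_) (+-comm k 1) ⟩
      (n ∸ k) C suc k    ≤⟨ tree-indepCount-lowerBound tree (suc k) ⟩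
      b                  ≤⟨ b≤y*[n∸k] ⟩
      y * (n ∸ k)        ≤⟨ *-monoʳ-≤ y (m∸n≤m n k) ⟩
      y * n              ∎

badTrees-mulLogLe : ∀ {n} (bad : Graph n → Bool) (X : Graph n → ℕ) c → 2 ≤ n →
  (∀ G → T (isTreeB G) → T (bad G) → c ≤ X G * n × 1 ≤ X G) →
  MulLogLe ((∑[ G ∈ labelledTrees n ] X G) * n ^ 2) n (c * numTrees n) →
  MulLogLe (countB bad (labelledTrees n) * n) n (numTrees n)
badTrees-mulLogLe {n} bad X c 2≤n bounded = mulLogLe-cancel 2≤n bad*c≤S*n bad≤S
  where
    trees : List (Graph n)
    trees = labelledTrees n
    all-trees : All (T ∘ isTreeB) trees
    all-trees = all-filter (λ G → T? (isTreeB G)) (allGraphs n)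
    bad*c≤S*n : countB bad trees * c ≤ (∑[ G ∈ trees ] X G) * n
    bad*c≤S*n = ≤-trans (countB-*-≤-∑ˡ trees (All.map (λ {G} t b → proj₁ (bounded G t b)) all-trees))
                        (≤-reflexive (∑ˡ-*ʳ X n trees))
    bad≤S : countB bad trees ≤ ∑[ G ∈ trees ] X G
    bad≤S = ≤-trans (≤-reflexive (sym (*-identityʳ _)))
                    (countB-*-≤-∑ˡ trees (All.map (λ {G} t b → proj₂ (bounded G t b)) all-trees))

claim2p3 : (n k : ℕ) → k + 2 ≤ n →
    (MulLogLe (S₁ n k * n ^ 2) n (((n + 1 ∸ k) C k) * numTrees n) →
       MulLogLe (bad₁ n k * n) n (numTrees n))
    × (MulLogLe (S₂ n k * n ^ 2) n (((n ∸ k) C (k + 1)) * numTrees n) →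
       MulLogLe (bad₂ n k * n) n (numTrees n))
claim2p3 n k k+2≤n =
    badTrees-mulLogLe _ (λ G → lowExtCount G k) _ 2≤n (λ G tree bad → lowExtCount-bound k tree k+2≤n bad)
  , badTrees-mulLogLe _ (λ G → highExtCount G k) _ 2≤n (λ G tree bad → highExtCount-bound k tree bad)
  where
    2≤n : 2 ≤ n
    2≤n = ≤-trans (m≤n+m 2 k) k+2≤n
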